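{- There is a constant $C>0$ such that for every integer $n\ge 2$, the class of all connected $n$-vertex graphs has a hierarchical distance-vector labelling scheme with labels of at most $n\log 3+C\log^2 n$ bits.
   Context: Graphs are finite; $d_G(u,v)$ is the distance in $G$; $\log$ is the binary logarithm. A hierarchical decomposition of $G$ is a pair $(T,(B_t)_{t\in V(T)})$ where $T$ is a rooted tree and $(B_t)$ is a partition of $V(G)$ into non-empty sets (bags) indexed by the nodes of $T$, such that for every edge $uv\in E(G)$, the node of $u$'s bag is an ancestor in $T$ (every node being its own ancestor) of the node of $v$'s bag, or vice versa. Given an ordering $v_1,\dots,v_n$ of $V(G)$, the $V(G)$-index of $v_j$ is $j$. A vertex $u$ is an ancestor of $v$ if either $u$'s bag is indexed by a strict ancestor of the node of $v$'s bag, or $u,v$ lie in the same bag and the index of $u$ is at most that of $v$. The natural ordering of the ancestors of $v$: if $t_1,\dots,t_k$ are the nodes on the path from the root $t_1$ to the node $t_k$ whose bag contains $v$, list for $i=1,\dots,k$ in order the vertices of $B_{t_i}$ sorted by increasing index, where for $B_{t_k}$ only vertices of index at most that of $v$ are listed. A hierarchical distance-vector labelling scheme for a class $\mathcal{C}$ with labels of at most $k$ bits is a function $D$ from finite binary strings to pairs of finite sequences of natural numbers such that for every $G\in\mathcal{C}$ with $n$ vertices there exist an ordering $v_1,\dots,v_n$ of $V(G)$, a function $\ell_G:V(G)\to\{0,1\}^*$ with $|\ell_G(v)|\le k$ for all $v$, and a hierarchical decomposition of $G$ such that for every $v$, $D(\ell_G(v))=(p(v),x(v))$, where $p(v)$ is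 the sequence of $V(G)$-indices of the ancestors of $v$ in their natural ordering, and $x(v)$ has the same length with $i$-th entry $d_G(v,v_{p(v)_i})$. -}

module Defs where

open import Data.Nat using (ℕ; zero; suc; _+_; _*_; _∸_; _^_; _≤_; _<_)
open import Data.Nat.Logarithm using (⌊log₂_⌋)
open import Data.Fin using (Fin; toℕ)
open import Data.Bool using (Bool; true; false)
open import Data.List using (List; length; map)
open import Data.List.Membership.Propositional using (_∈_)
open import Data.List.Relation.Unary.AllPairs using (AllPairs)
open import Data.List.Relation.Binary.Pointwise using (Pointwise)
open import Data.Product using (Σ; ∃; _×_; _,_)
open import Data.Sum using (_⊎_)
open import Relation.Binary.PropositionalEquality using (_≡_; _≢_)
open import Function.Definitions using (Injective)

record Graph (n : ℕ) : Set where
  field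
    adj     : Fin n → Fin n → Bool
    adj-sym : ∀ u v → adj u v ≡ adj v u
    adj-irr : ∀ v → adj v v ≡ false
open Graph public

data Walk {n : ℕ} (G : Graph n) : Fin n → Fin n → ℕ → Set where
  here : ∀ {v} → Walk G v v zero
  step : ∀ {u w v k} → adj G u w ≡ true → Walk G w v k → Walk G u v (suc k)

Connected : ∀ {n} → Graph n → Set
Connected G = ∀ u v → ∃ λ k → Walk G u v k

IsDist : ∀ {n} → Graph n → Fin n → Fin n → ℕ → Set
IsDist G u v d = Walk G u v d × (∀ k → Walk G u v k → d ≤ k)

iter : ∀ {A : Set} → (A → A) → ℕ → A → A
iter f zero    a = a
iter f (suc k) a = f (iter f k a)

record RootedTree (m : ℕ) : Set where
  field
    root        : Fin m
    parent      : Fin m → Fin m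
    parent-root : parent root ≡ root
    reaches     : ∀ t → ∃ λ k → iter parent k t ≡ root
open RootedTree public

NodeAnc : ∀ {m} → RootedTree m → Fin m → Fin m → Set
NodeAnc T s t = ∃ λ k → iter (parent T) k t ≡ s

StrictNodeAnc : ∀ {m} → RootedTree m → Fin m → Fin m → Set
StrictNodeAnc T s t = NodeAnc T s t × s ≢ t

record HierDecomp {n : ℕ} (G : Graph n) : Set where
  field
    m        : ℕ
    tree     : RootedTree m
    bag      : Fin n → Fin m
    bag-ne   : ∀ t → ∃ λ v → bag v ≡ t
    edge-anc : ∀ u v → adj G u v ≡ true →
               NodeAnc tree (bag u) (bag v) ⊎ NodeAnc tree (bag v) (bag u)
open HierDecomp public

-- An ordering v_1,…,v_n of V(G) = Fin n is given by an injective map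
-- pos : Fin n → Fin n (vertex ↦ position, 0-based); the V(G)-index is 1 + position.
index : ∀ {n} → (Fin n → Fin n) → Fin n → ℕ
index pos v = suc (toℕ (pos v))

VAnc : ∀ {n} {G : Graph n} → (Fin n → Fin n) → HierDecomp G → Fin n → Fin n → Set
VAnc pos H u v = StrictNodeAnc (tree H) (bag H u) (bag H v)
               ⊎ (bag H u ≡ bag H v × index pos u ≤ index pos v)

Before : ∀ {n} {G : Graph n} → (Fin n → Fin n) → HierDecomp G → Fin n → Fin n → Set
Before pos H u w = StrictNodeAnc (tree H) (bag H u) (bag H w)
                 ⊎ (bag H u ≡ bag H w × index pos u < index pos w)

NaturalAncestors : ∀ {n} {G : Graph n} → (Fin n → Fin n) → HierDecomp G → Fin n → List (Fin n) → Set
NaturalAncestors pos H v as =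
  (∀ u → (u ∈ as → VAnc pos H u v) × (VAnc pos H u v → u ∈ as))
  × AllPairs (Before pos H) as

-- Label length bound |ℓ| ≤ n log 3 + C ⌊log n⌋², stated exactly over ℕ
-- (integer k satisfies k - X ≤ n log 3 iff 2^(k - X) ≤ 3^n).
LabelFits : ℕ → ℕ → List Bool → Set
LabelFits C n l = 2 ^ (length l ∸ C * (⌊log₂ n ⌋ ^ 2)) ≤ 3 ^ n

HasHDVScheme : (n : ℕ) → (List Bool → Set) → Set
HasHDVScheme n Fits =
  Σ (List Bool → List ℕ × List ℕ) λ D →
  ∀ (G : Graph n) → Connected G →
  Σ (Fin n → Fin n) λ pos → Injective _≡_ _≡_ pos ×
  Σ (Fin n → List Bool) λ ℓ →
  Σ (HierDecomp G) λ H →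
  ∀ v → Fits (ℓ v) ×
        Σ (List (Fin n)) λ as → NaturalAncestors pos H v as ×
        Σ (List ℕ) λ xs → Pointwise (λ a d → IsDist G v a d) as xs ×
        D (ℓ v) ≡ (map (index pos) as , xs)

-- A connected set S is cut by a path P starting at a chosen root such that every component of
-- S ∖ P has at most half of the vertices (walk into the big component while there is one);
-- P comes first and the components are decomposed recursively.  With one vertex per bag,
-- the ancestors of v then form at most 1 + log n runs, each of them a path whose vertices are
-- consecutive in the vertex order.  Along a run the index grows by one and the distance to v
-- changes by at most one, so a run is determined by its first index, first distance and
-- length (O(log n) bits) plus one trit per further vertex.  The label is therefore a number
-- below (2 (n + 2)³)^(1 + log n) · 3^n, which has n log 3 + O(log² n) bits.

{-# OPTIONS --safe #-}
module Submission where

open import Data.Bool using (Bool; true; false; _∨_; _∧_; not; if_then_else_)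
import Data.Bool as Bool
open import Data.Bool.Properties using (∨-identityʳ; ∨-assoc; ∧-zeroʳ; ¬-not)
open import Data.Empty using (⊥; ⊥-elim)
open import Data.Fin using (Fin; zero; suc; toℕ; fromℕ<)
open import Data.Fin.Properties using (_≟_; any?; pigeonhole; toℕ-fromℕ<; toℕ<n)
import Data.Fin.Properties as Fin
open import Data.List using (List; []; _∷_; length; _++_; _∷ʳ_; [_]; concat; map; lookup; initLast; _∷ʳ′_)
open import Data.List.Properties using (++-assoc; ++-identityʳ; ∷ʳ-++; ∷-injective; length-++; length-map; map-∘; concat-map)
open import Data.List.Membership.Propositional using (_∈_; _∉_)
open import Data.List.Membership.Propositional.Properties using (∈-++⁺ˡ; ∈-++⁺ʳ; ∈-++⁻; ∈-∃++; ∈-lookup)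
open import Data.List.Relation.Binary.Pointwise using (Pointwise; []; _∷_)
open import Data.List.Relation.Unary.All as All using (All; []; _∷_)
import Data.List.Relation.Unary.All.Properties as All
open import Data.List.Relation.Unary.AllPairs using (AllPairs; []; _∷_)
open import Data.List.Relation.Unary.Any using (here; there)
open import Data.List.Relation.Unary.Linked using (Linked; []; [-]; _∷_)
open import Data.List.Relation.Unary.Unique.Propositional using (Unique)
import Data.List.Relation.Unary.Unique.Propositional.Properties as Unique
open import Data.List.Relation.Unary.Unique.Propositional.Properties using (Unique[x∷xs]⇒x∉xs)
open import Data.Nat using (ℕ; zero; suc; _+_; _*_; _∸_; _^_; _≤_; _<_; z≤n; s≤s; _<?_; _≤?_; _≡ᵇ_; NonZero; _/_; _%_)
open import Data.Nat.Binary as ℕᵇ using (ℕᵇ; zero; 2[1+_]; 1+[2_])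
open import Data.Nat.Binary.Properties using (toℕ-fromℕ)
open import Data.Nat.DivMod using ([m+kn]%n≡m%n; m<n⇒m%n≡m; +-distrib-/-∣ʳ; m<n⇒m/n≡0; m*n/n≡m)
open import Data.Nat.Divisibility using (n∣m*n)
open import Data.Nat.Logarithm using (⌊log₂_⌋; ⌊log₂⌋-mono-≤; ⌊log₂[2^n]⌋≡n; ⌊log₂[2*b]⌋≡1+⌊log₂b⌋)
open import Data.Nat.Properties hiding (_≟_)
open import Algebra.Properties.CommutativeSemigroup +-commutativeSemigroup using (interchange)
open import Data.Nat.Tactic.RingSolver using (solve-∀)
open import Data.Product using (Σ; ∃; ∃₂; _×_; _,_; proj₁; proj₂)
open import Data.Sum using (_⊎_; inj₁; inj₂)
import Data.Sum as Sum
open import Function using (_∘_)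
open import Function.Definitions using (Injective)
open import Relation.Binary.PropositionalEquality hiding ([_])
open import Relation.Nullary using (¬_; Dec; yes; no)
open import Relation.Nullary.Decidable using (⌊_⌋; _×-dec_)

open import Defs

∨-introˡ : ∀ {a} b → a ≡ true → a ∨ b ≡ true
∨-introˡ b refl = refl

∨-introʳ : ∀ a {b} → b ≡ true → a ∨ b ≡ true
∨-introʳ false refl = refl
∨-introʳ true  refl = refl

∨-elim : ∀ a {b} → a ∨ b ≡ true → a ≡ true ⊎ b ≡ true
∨-elim true  _ = inj₁ refl
∨-elim false p = inj₂ p

∧-intro : ∀ {a b} → a ≡ true → b ≡ true → a ∧ b ≡ true
∧-intro refl refl = refl

∧-elimˡ : ∀ a {b} → a ∧ b ≡ true → a ≡ true
∧-elimˡ true _ = refl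

∧-elimʳ : ∀ a {b} → a ∧ b ≡ true → b ≡ true
∧-elimʳ true p = p

false≢true : false ≢ true
false≢true ()

Sub : ℕ → Set
Sub n = Fin n → Bool

_⊆_ : ∀ {n} → Sub n → Sub n → Set
S ⊆ T = ∀ x → S x ≡ true → T x ≡ true

_∖_ : ∀ {n} → Sub n → Sub n → Sub n
(S ∖ C) x = S x ∧ not (C x)

∖-⊆ : ∀ {n} (S C : Sub n) → (S ∖ C) ⊆ S
∖-⊆ S C x = ∧-elimˡ (S x)

∖-intro : ∀ {n} (S C : Sub n) x → S x ≡ true → C x ≡ false → (S ∖ C) x ≡ true
∖-intro S C x s c rewrite s | c = refl

∖-excludes : ∀ {n} (S C : Sub n) x → C x ≡ true → (S ∖ C) x ≡ false
∖-excludes S C x c rewrite c = ∧-zeroʳ (S x)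

∖-disjoint : ∀ {n} (S C : Sub n) x → (S ∖ C) x ≡ true → C x ≡ true → ⊥
∖-disjoint S C x t c = false≢true (trans (sym (∖-excludes S C x c)) t)

indicator : Bool → ℕ
indicator true  = 1
indicator false = 0

indicator-mono : ∀ {a b} → (a ≡ true → b ≡ true) → indicator a ≤ indicator b
indicator-mono {false} _ = z≤n
indicator-mono {true}  p rewrite p refl = ≤-refl

count : ∀ {k} → Sub k → ℕ
count {zero}  f = 0
count {suc k} f = indicator (f zero) + count (f ∘ suc)

count-≤ : ∀ {k} (f : Sub k) → count f ≤ k
count-≤ {zero}  f = z≤n
count-≤ {suc k} f with f zero
... | true  = s≤s (count-≤ (f ∘ suc))
... | false = m≤n⇒m≤1+n (count-≤ (f ∘ suc))

count-mono : ∀ {k} (f g : Sub k) → f ⊆ g → count f ≤ count g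
count-mono {zero}  f g p = z≤n
count-mono {suc k} f g p = +-mono-≤ (indicator-mono (p zero)) (count-mono (f ∘ suc) (g ∘ suc) (p ∘ suc))

count-monoˢ : ∀ {k} (f g : Sub k) → f ⊆ g →
              ∀ x → g x ≡ true → f x ≡ false → count f < count g
count-monoˢ {suc k} f g p zero gx fx rewrite gx | fx = s≤s (count-mono (f ∘ suc) (g ∘ suc) (p ∘ suc))
count-monoˢ {suc k} f g p (suc x) gx fx =
  +-mono-≤-< (indicator-mono (p zero)) (count-monoˢ (f ∘ suc) (g ∘ suc) (p ∘ suc) x gx fx)

count-pos : ∀ {k} (f : Sub k) x → f x ≡ true → 0 < count f
count-pos f x fx = ≤-trans (s≤s z≤n) (count-monoˢ (λ _ → false) f (λ _ ()) x fx refl)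

count-+-≤ : ∀ {k} (f g h : Sub k) → (∀ x → indicator (f x) + indicator (g x) ≤ indicator (h x)) →
            count f + count g ≤ count h
count-+-≤ {zero}  f g h p = z≤n
count-+-≤ {suc k} f g h p = begin
  (indicator (f zero) + count (f ∘ suc)) + (indicator (g zero) + count (g ∘ suc))
    ≡⟨ interchange (indicator (f zero)) _ _ _ ⟩
  (indicator (f zero) + indicator (g zero)) + (count (f ∘ suc) + count (g ∘ suc))
    ≤⟨ +-mono-≤ (p zero) (count-+-≤ (f ∘ suc) (g ∘ suc) (h ∘ suc) (p ∘ suc)) ⟩
  indicator (h zero) + count (h ∘ suc) ∎
  where open ≤-Reasoning

anyᵇ : ∀ {k} → Sub k → Bool
anyᵇ {zero}  f = false
anyᵇ {suc k} f = f zero ∨ anyᵇ (f ∘ suc)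

anyᵇ-sound : ∀ {k} (f : Sub k) → anyᵇ f ≡ true → ∃ λ x → f x ≡ true
anyᵇ-sound {suc k} f e with f zero in eq
... | true  = zero , eq
... | false = let x , p = anyᵇ-sound (f ∘ suc) e in suc x , p

anyᵇ-complete : ∀ {k} (f : Sub k) x → f x ≡ true → anyᵇ f ≡ true
anyᵇ-complete {suc k} f zero    p rewrite p = refl
anyᵇ-complete {suc k} f (suc x) p = ∨-introʳ (f zero) (anyᵇ-complete (f ∘ suc) x p)

anyᵇ-cong : ∀ {k} {f g : Sub k} → (∀ x → f x ≡ g x) → anyᵇ f ≡ anyᵇ g
anyᵇ-cong {zero}  e = refl
anyᵇ-cong {suc k} e = cong₂ _∨_ (e zero) (anyᵇ-cong (e ∘ suc))

eqᵇ : ∀ {k} → Fin k → Fin k → Bool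
eqᵇ x y = ⌊ x ≟ y ⌋

eqᵇ-sound : ∀ {k} {x y : Fin k} → eqᵇ x y ≡ true → x ≡ y
eqᵇ-sound {x = x} {y} e with x ≟ y
... | yes p = p

eqᵇ-refl : ∀ {k} (x : Fin k) → eqᵇ x x ≡ true
eqᵇ-refl x with x ≟ x
... | yes _ = refl
... | no ¬p = ⊥-elim (¬p refl)

eqᵇ-≢ : ∀ {k} {x y : Fin k} → x ≢ y → eqᵇ x y ≡ false
eqᵇ-≢ {x = x} {y} ne with x ≟ y
... | yes p = ⊥-elim (ne p)
... | no _  = refl

_∈ᵇ_ : ∀ {k} → Fin k → List (Fin k) → Bool
y ∈ᵇ []       = false
y ∈ᵇ (x ∷ xs) = eqᵇ y x ∨ y ∈ᵇ xs

∈ᵇ-sound : ∀ {k} (y : Fin k) xs → y ∈ᵇ xs ≡ true → y ∈ xs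
∈ᵇ-sound y (x ∷ xs) e with y ≟ x
... | yes refl = here refl
... | no _     = there (∈ᵇ-sound y xs e)

∈ᵇ-complete : ∀ {k} {y : Fin k} {xs} → y ∈ xs → y ∈ᵇ xs ≡ true
∈ᵇ-complete {y = y} (here refl) rewrite eqᵇ-refl y = refl
∈ᵇ-complete {y = y} {x ∷ xs} (there m) = ∨-introʳ (eqᵇ y x) (∈ᵇ-complete m)

∈ᵇ-∷ʳ : ∀ {k} (z : Fin k) xs y → z ∈ᵇ (xs ∷ʳ y) ≡ z ∈ᵇ xs ∨ eqᵇ z y
∈ᵇ-∷ʳ z []       y = ∨-identityʳ (eqᵇ z y)
∈ᵇ-∷ʳ z (x ∷ xs) y = trans (cong (eqᵇ z x ∨_) (∈ᵇ-∷ʳ z xs y)) (sym (∨-assoc (eqᵇ z x) _ _))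

module _ {A : Set} where

  AllPairs-++⁻ˡ : ∀ {R : A → A → Set} xs {ys} → AllPairs R (xs ++ ys) → AllPairs R xs
  AllPairs-++⁻ˡ []       _        = []
  AllPairs-++⁻ˡ (x ∷ xs) (p ∷ ps) = All.++⁻ˡ xs p ∷ AllPairs-++⁻ˡ xs ps

  AllPairs-++⁻ʳ : ∀ {R : A → A → Set} xs {ys} → AllPairs R (xs ++ ys) → AllPairs R ys
  AllPairs-++⁻ʳ []       ps       = ps
  AllPairs-++⁻ʳ (x ∷ xs) (_ ∷ ps) = AllPairs-++⁻ʳ xs ps

  Unique-∷ʳ : ∀ {xs} {y : A} → Unique xs → y ∉ xs → Unique (xs ∷ʳ y)
  Unique-∷ʳ u y∉ = Unique.++⁺ u ([] ∷ []) λ { (m , here refl) → y∉ m }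

  Unique-lookup-injective : ∀ {xs : List A} → Unique xs → ∀ {i j} → lookup xs i ≡ lookup xs j → i ≡ j
  Unique-lookup-injective (_  ∷ _) {zero}  {zero}  _ = refl
  Unique-lookup-injective (x≢ ∷ _) {zero}  {suc j} e = ⊥-elim (All.lookup x≢ (∈-lookup j) e)
  Unique-lookup-injective (x≢ ∷ _) {suc i} {zero}  e = ⊥-elim (All.lookup x≢ (∈-lookup i) (sym e))
  Unique-lookup-injective (_  ∷ u) {suc i} {suc j} e = cong suc (Unique-lookup-injective u e)

  Linked-∷ʳ : ∀ {R : A → A → Set} xs {x y} → Linked R (xs ∷ʳ x) → R x y → Linked R (xs ∷ʳ x ∷ʳ y)
  Linked-∷ʳ []           [-]      r = r ∷ [-]
  Linked-∷ʳ (a ∷ [])     (r' ∷ l) r = r' ∷ Linked-∷ʳ [] l r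
  Linked-∷ʳ (a ∷ b ∷ xs) (r' ∷ l) r = r' ∷ Linked-∷ʳ (b ∷ xs) l r

  Linked-++⁻ˡ : ∀ {R : A → A → Set} xs {ys} → Linked R (xs ++ ys) → Linked R xs
  Linked-++⁻ˡ []           _       = []
  Linked-++⁻ˡ (x ∷ [])     _       = [-]
  Linked-++⁻ˡ (x ∷ y ∷ xs) (r ∷ l) = r ∷ Linked-++⁻ˡ (y ∷ xs) l

  Pointwise-map : ∀ {B : Set} {R : A → B → Set} {f : A → B} → (∀ x → R x (f x)) →
                  ∀ xs → Pointwise R xs (map f xs)
  Pointwise-map r []       = []
  Pointwise-map r (x ∷ xs) = r x ∷ Pointwise-map r xs

  length-++-∷ : ∀ (xs : List A) v ys → length xs < length (xs ++ v ∷ ys)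
  length-++-∷ []       v ys = s≤s z≤n
  length-++-∷ (x ∷ xs) v ys = s≤s (length-++-∷ xs v ys)

  length-infix : ∀ (xs r ys : List A) → length r ≤ length (xs ++ r ++ ys)
  length-infix xs r ys = begin
    length r                     ≤⟨ m≤m+n (length r) (length ys) ⟩
    length r + length ys         ≡⟨ sym (length-++ r) ⟩
    length (r ++ ys)             ≤⟨ m≤n+m _ (length xs) ⟩
    length xs + length (r ++ ys) ≡⟨ sym (length-++ xs) ⟩
    length (xs ++ r ++ ys)       ∎
    where open ≤-Reasoning

  element-at-≡ : ∀ (xs ys : List A) {u v : A} {zs ws} → xs ++ u ∷ zs ≡ ys ++ v ∷ ws →
                 length xs ≡ length ys → u ≡ v
  element-at-≡ []       []       e _ = proj₁ (∷-injective e)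
  element-at-≡ (x ∷ xs) (y ∷ ys) e l = element-at-≡ xs ys (proj₂ (∷-injective e)) (suc-injective l)

  ++-∷-split : ∀ (P Q xs : List A) {a zs} → P ++ Q ≡ xs ++ a ∷ zs →
               (∃ λ ws → P ≡ xs ++ a ∷ ws) ⊎ (∃ λ xs' → xs ≡ P ++ xs' × Q ≡ xs' ++ a ∷ zs)
  ++-∷-split []      Q xs       e = inj₂ (xs , refl , e)
  ++-∷-split (p ∷ P) Q []       e with ∷-injective e
  ... | refl , _ = inj₁ (P , refl)
  ++-∷-split (p ∷ P) Q (x ∷ xs) e with ∷-injective e
  ... | refl , e' with ++-∷-split P Q xs e'
  ... | inj₁ (ws , eP)         = inj₁ (ws , cong (p ∷_) eP)
  ... | inj₂ (xs' , exs , eQ) = inj₂ (xs' , cong (p ∷_) exs , eQ)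

  penultimate : A → List A → A
  penultimate d []           = d
  penultimate d (x ∷ [])     = d
  penultimate d (x ∷ y ∷ zs) = penultimate x (y ∷ zs)

  penultimate-++ : ∀ (d : A) xs p v → penultimate d (xs ++ p ∷ v ∷ []) ≡ p
  penultimate-++ d []           p v = refl
  penultimate-++ d (x ∷ [])     p v = refl
  penultimate-++ d (x ∷ y ∷ xs) p v = penultimate-++ x (y ∷ xs) p v

  iter-suc : ∀ (f : A → A) k a → iter f (suc k) a ≡ iter f k (f a)
  iter-suc f zero    a = refl
  iter-suc f (suc k) a = cong f (iter-suc f k a)

  iter-fixed : ∀ (f : A → A) k a → f a ≡ a → iter f k a ≡ a
  iter-fixed f zero    a e = refl
  iter-fixed f (suc k) a e = trans (cong f (iter-fixed f k a e)) e

Unique-length : ∀ {k} (xs : List (Fin k)) → Unique xs → length xs ≤ k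
Unique-length xs u = ≮⇒≥ λ k<len →
  let i , j , i<j , e = pigeonhole k<len (lookup xs)
  in Fin.<⇒≢ i<j (Unique-lookup-injective u e)

module _ {k : ℕ} where

  indexOf : Fin k → List (Fin k) → ℕ
  indexOf v []       = 0
  indexOf v (x ∷ xs) = if eqᵇ x v then 0 else suc (indexOf v xs)

  takeThrough : Fin k → List (Fin k) → List (Fin k)
  takeThrough v []       = []
  takeThrough v (x ∷ xs) = if eqᵇ x v then x ∷ [] else x ∷ takeThrough v xs

  eqᵇ-≢-before : ∀ x xs (v : Fin k) ys → Unique (x ∷ xs ++ v ∷ ys) → eqᵇ x v ≡ false
  eqᵇ-≢-before x xs v ys (x≢ ∷ _) = eqᵇ-≢ (All.lookup x≢ (∈-++⁺ʳ xs (here refl)))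

  indexOf-++ : ∀ xs v ys → Unique (xs ++ v ∷ ys) → indexOf v (xs ++ v ∷ ys) ≡ length xs
  indexOf-++ []       v ys u rewrite eqᵇ-refl v = refl
  indexOf-++ (x ∷ xs) v ys u@(_ ∷ u') rewrite eqᵇ-≢-before x xs v ys u = cong suc (indexOf-++ xs v ys u')

  takeThrough-++ : ∀ xs v ys → Unique (xs ++ v ∷ ys) → takeThrough v (xs ++ v ∷ ys) ≡ xs ∷ʳ v
  takeThrough-++ []       v ys u rewrite eqᵇ-refl v = refl
  takeThrough-++ (x ∷ xs) v ys u@(_ ∷ u') rewrite eqᵇ-≢-before x xs v ys u = cong (x ∷_) (takeThrough-++ xs v ys u')

  takeThrough-head : ∀ v r ps → ∃ λ ys → takeThrough v (r ∷ ps) ≡ r ∷ ys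
  takeThrough-head v r ps with eqᵇ r v
  ... | true  = [] , refl
  ... | false = takeThrough v ps , refl

module Components {n : ℕ} (G : Graph n) where

  V : Set
  V = Fin n

  walk-∷ʳ : ∀ {u v w k} → Walk G u v k → adj G v w ≡ true → Walk G u w (suc k)
  walk-∷ʳ here       a = step a here
  walk-∷ʳ (step a' w) a = step a' (walk-∷ʳ w a)

  data PathIn (T : Sub n) : V → V → Set where
    done : ∀ {x} → T x ≡ true → PathIn T x x
    move : ∀ {x y z} → T x ≡ true → adj G x y ≡ true → PathIn T y z → PathIn T x z

  PathIn-source : ∀ {T x y} → PathIn T x y → T x ≡ true
  PathIn-source (done p)     = p
  PathIn-source (move p _ _) = p

  PathIn-target : ∀ {T x y} → PathIn T x y → T y ≡ true
  PathIn-target (done p)     = p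
  PathIn-target (move _ _ w) = PathIn-target w

  PathIn-trans : ∀ {T x y z} → PathIn T x y → PathIn T y z → PathIn T x z
  PathIn-trans (done _)     w' = w'
  PathIn-trans (move p a w) w' = move p a (PathIn-trans w w')

  PathIn-∷ʳ : ∀ {T x y z} → PathIn T x y → adj G y z ≡ true → T z ≡ true → PathIn T x z
  PathIn-∷ʳ w a tz = PathIn-trans w (move (PathIn-target w) a (done tz))

  PathIn-sym : ∀ {T x y} → PathIn T x y → PathIn T y x
  PathIn-sym (done p)               = done p
  PathIn-sym (move {x} {y} p a w) = PathIn-∷ʳ (PathIn-sym w) (trans (adj-sym G y x) a) p

  PathIn-mono : ∀ {T T'} → T ⊆ T' → ∀ {x y} → PathIn T x y → PathIn T' x y
  PathIn-mono s (done p)     = done (s _ p)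
  PathIn-mono s (move p a w) = move (s _ p) a (PathIn-mono s w)

  ClosedIn : Sub n → Sub n → Set
  ClosedIn C T = ∀ a b → C a ≡ true → T b ≡ true → adj G a b ≡ true → C b ≡ true

  PathIn-restrict : ∀ {C T} → ClosedIn C T → ∀ {x y} → PathIn T x y → C x ≡ true → PathIn C x y
  PathIn-restrict cl (done p)     cx = done cx
  PathIn-restrict cl (move p a w) cx = move cx a (PathIn-restrict cl w (cl _ _ cx (PathIn-source w) a))

  Connected-within : Sub n → Set
  Connected-within S = ∀ x y → S x ≡ true → S y ≡ true → PathIn S x y

  reachStep : Sub n → Sub n → Sub n
  reachStep T R x = R x ∨ (T x ∧ anyᵇ (λ y → R y ∧ adj G y x))

  reach : Sub n → V → ℕ → Sub n
  reach T u zero    x = T x ∧ eqᵇ x u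
  reach T u (suc k) = reachStep T (reach T u k)

  component : Sub n → V → Sub n
  component T u = reach T u (suc n)

  reach-suc : ∀ {T u} k → reach T u k ⊆ reach T u (suc k)
  reach-suc k x = ∨-introˡ _

  reach-suc-cases : ∀ T u k x → reach T u (suc k) x ≡ true →
                    reach T u k x ≡ true ⊎ (T x ≡ true × ∃ λ y → reach T u k y ≡ true × adj G y x ≡ true)
  reach-suc-cases T u k x p with ∨-elim (reach T u k x) p
  ... | inj₁ q = inj₁ q
  ... | inj₂ q =
    let y , r = anyᵇ-sound (λ y → reach T u k y ∧ adj G y x) (∧-elimʳ (T x) q)
    in inj₂ (∧-elimˡ (T x) q , y , ∧-elimˡ (reach T u k y) r , ∧-elimʳ (reach T u k y) r)

  reach-⊆ : ∀ T u k → reach T u k ⊆ T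
  reach-⊆ T u zero    x p = ∧-elimˡ (T x) p
  reach-⊆ T u (suc k) x p with reach-suc-cases T u k x p
  ... | inj₁ q        = reach-⊆ T u k x q
  ... | inj₂ (tx , _) = tx

  reach-zero : ∀ T u x → reach T u zero x ≡ true → x ≡ u
  reach-zero T u x p = eqᵇ-sound (∧-elimʳ (T x) p)

  reach-PathIn : ∀ T u k x → reach T u k x ≡ true → PathIn T u x
  reach-PathIn T u zero x p with reach-zero T u x p
  ... | refl = done (reach-⊆ T u zero x p)
  reach-PathIn T u (suc k) x p with reach-suc-cases T u k x p
  ... | inj₁ q                  = reach-PathIn T u k x q
  ... | inj₂ (tx , y , ry , a) = PathIn-∷ʳ (reach-PathIn T u k y ry) a tx

  reach-walk : ∀ T u k x → reach T u k x ≡ true → ∃ λ j → j ≤ k × Walk G u x j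
  reach-walk T u zero x p with reach-zero T u x p
  ... | refl = 0 , z≤n , here
  reach-walk T u (suc k) x p with reach-suc-cases T u k x p
  ... | inj₁ q = let j , j≤k , w = reach-walk T u k x q in j , m≤n⇒m≤1+n j≤k , w
  ... | inj₂ (tx , y , ry , a) =
    let j , j≤k , w = reach-walk T u k y ry in suc j , s≤s j≤k , walk-∷ʳ w a

  StableAt : Sub n → V → ℕ → Set
  StableAt T u j = ∀ x → reach T u (suc j) x ≡ reach T u j x

  reachStep-cong : ∀ T {R₁ R₂ : Sub n} → (∀ x → R₁ x ≡ R₂ x) →
                   ∀ x → reachStep T R₁ x ≡ reachStep T R₂ x
  reachStep-cong T e x = cong₂ _∨_ (e x) (cong (T x ∧_) (anyᵇ-cong (λ y → cong (_∧ adj G y x) (e y))))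

  stable-+ : ∀ T u j → StableAt T u j → ∀ i x → reach T u (i + j) x ≡ reach T u j x
  stable-+ T u j st zero    x = refl
  stable-+ T u j st (suc i) x = trans (reachStep-cong T (stable-+ T u j st i) x) (st x)

  stable-≤ : ∀ T u j → StableAt T u j → ∀ m → j ≤ m → ∀ x → reach T u m x ≡ reach T u j x
  stable-≤ T u j st m j≤m x =
    let o , j+o≡m = m≤n⇒∃[o]m+o≡n j≤m
    in trans (cong (λ z → reach T u z x) (trans (sym j+o≡m) (+-comm j o))) (stable-+ T u j st o x)

  stable-or-grows : ∀ T u k → StableAt T u k ⊎ count (reach T u k) < count (reach T u (suc k))
  stable-or-grows T u k with any? (λ x → (reach T u (suc k) x Bool.≟ true) ×-dec (reach T u k x Bool.≟ false))
  ... | yes (x , new , old) = inj₂ (count-monoˢ _ _ (reach-suc k) x new old)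
  ... | no none = inj₁ stable
    where
    stable : StableAt T u k
    stable x with reach T u (suc k) x Bool.≟ true | reach T u k x Bool.≟ true
    ... | _       | yes old = trans (reach-suc k x old) (sym old)
    ... | yes new | no old  = ⊥-elim (none (x , new , ¬-not old))
    ... | no new  | no old  = trans (¬-not new) (sym (¬-not old))

  stable-or-large : ∀ T u k → (∃ λ j → j ≤ k × StableAt T u j) ⊎ k ≤ count (reach T u k)
  stable-or-large T u zero = inj₂ z≤n
  stable-or-large T u (suc k) with stable-or-large T u k
  ... | inj₁ (j , j≤k , st) = inj₁ (j , m≤n⇒m≤1+n j≤k , st)
  ... | inj₂ k≤c with stable-or-grows T u k
  ... | inj₁ st = inj₁ (k , n≤1+n k , st)
  ... | inj₂ lt = inj₂ (≤-trans (s≤s k≤c) lt)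

  stabilises : ∀ T u → ∃ λ j → j ≤ suc n × StableAt T u j
  stabilises T u with stable-or-large T u (suc n)
  ... | inj₁ r  = r
  ... | inj₂ le = ⊥-elim (1+n≰n (≤-trans le (count-≤ (reach T u (suc n)))))

  component-step : ∀ T u x → reach T u (suc (suc n)) x ≡ component T u x
  component-step T u x =
    let j , j≤ , st = stabilises T u
    in trans (stable-≤ T u j st (suc (suc n)) (m≤n⇒m≤1+n j≤) x) (sym (stable-≤ T u j st (suc n) j≤ x))

  component-closed : ∀ T u → ClosedIn (component T u) T
  component-closed T u a b ca tb ab =
    trans (sym (component-step T u b))
      (∨-introʳ (component T u b)
        (∧-intro tb (anyᵇ-complete (λ y → component T u y ∧ adj G y b) a (∧-intro ca ab))))

  reach-zero-⊆ : ∀ {T u} k → reach T u zero ⊆ reach T u k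
  reach-zero-⊆ zero    x p = p
  reach-zero-⊆ (suc k) x p = reach-suc k x (reach-zero-⊆ k x p)

  component-self : ∀ T u → T u ≡ true → component T u u ≡ true
  component-self T u tu = reach-zero-⊆ (suc n) u (∧-intro tu (eqᵇ-refl u))

  component-⊆ : ∀ T u → component T u ⊆ T
  component-⊆ T u = reach-⊆ T u (suc n)

  component-PathIn : ∀ T u x → component T u x ≡ true → PathIn T u x
  component-PathIn T u = reach-PathIn T u (suc n)

  PathIn-component : ∀ T u x → PathIn T u x → component T u x ≡ true
  PathIn-component T u x w = go u (component-self T u (PathIn-source w)) w
    where
    go : ∀ a → component T u a ≡ true → PathIn T a x → component T u x ≡ true
    go a ca (done _)      = ca
    go a ca (move _ ab w) = go _ (component-closed T u a _ ca (PathIn-source w) ab) w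

  component-mono : ∀ {T T'} → T ⊆ T' → ∀ u → component T u ⊆ component T' u
  component-mono {T} {T'} s u x c = PathIn-component T' u x (PathIn-mono s (component-PathIn T u x c))

  component-connected : ∀ T u → Connected-within (component T u)
  component-connected T u x y cx cy =
    PathIn-restrict (component-closed T u)
      (PathIn-trans (PathIn-sym (component-PathIn T u x cx)) (component-PathIn T u y cy)) cx

  component-walk : ∀ T u x → component T u x ≡ true → ∃ λ j → j ≤ suc n × Walk G u x j
  component-walk T u = reach-walk T u (suc n)

-- Balanced paths

two-halves-exceed : ∀ m a b → m < 2 * a → m < 2 * b → a + b ≤ m → ⊥
two-halves-exceed m a b p q s = <-irrefl refl (begin-strict
  m + m         <⟨ +-mono-< p q ⟩
  2 * a + 2 * b ≡⟨ sym (*-distribˡ-+ 2 a b) ⟩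
  2 * (a + b)   ≤⟨ *-monoʳ-≤ 2 s ⟩
  2 * m         ≡⟨ cong (m +_) (+-identityʳ m) ⟩
  m + m         ∎)
  where open ≤-Reasoning

half-≤ : ∀ c f → 2 * c ≤ suc f → 0 < c → c ≤ f
half-≤ c f 2c≤ 0<c = ≤-pred (begin
  suc c     ≡⟨ +-comm 1 c ⟩
  c + 1     ≤⟨ +-monoʳ-≤ c 0<c ⟩
  c + c     ≡⟨ cong (c +_) (sym (+-identityʳ c)) ⟩
  2 * c     ≤⟨ 2c≤ ⟩
  suc f     ∎)
  where open ≤-Reasoning

module BalancedPaths {n : ℕ} (G : Graph n) where
  open Components G

  Adj : V → V → Set
  Adj x y = adj G x y ≡ true

  big-components-meet : ∀ S T u u' → T ⊆ S →
                        count S < 2 * count (component T u) → count S < 2 * count (component T u') →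
                        ∃ λ z → component T u z ≡ true × component T u' z ≡ true
  big-components-meet S T u u' T⊆S big big'
    with any? (λ z → (component T u z Bool.≟ true) ×-dec (component T u' z Bool.≟ true))
  ... | yes meet = meet
  ... | no apart = ⊥-elim (two-halves-exceed (count S) (count (component T u)) (count (component T u')) big big'
                                              (count-+-≤ (component T u) (component T u') S disjoint))
    where
    disjoint : ∀ z → indicator (component T u z) + indicator (component T u' z) ≤ indicator (S z)
    disjoint z with component T u z in c | component T u' z in c'
    ... | true  | true  = ⊥-elim (apart (z , c , c'))
    ... | true  | false = indicator-mono (λ _ → T⊆S z (component-⊆ T u z c))
    ... | false | true  = indicator-mono (λ _ → T⊆S z (component-⊆ T u' z c'))
    ... | false | false = z≤n

  PathIn-last-step : ∀ {T T' a b} → PathIn T a b → a ≢ b → T' a ≡ true →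
                     (∀ z → T z ≡ true → z ≢ b → T' z ≡ true) →
                     ∃ λ z → PathIn T' a z × Adj z b
  PathIn-last-step (done _) a≢b _ _ = ⊥-elim (a≢b refl)
  PathIn-last-step {b = b} (move {y = c} _ ac w) a≢b t'a keep with c ≟ b
  ... | yes refl = _ , done t'a , ac
  ... | no c≢b =
    let z , w' , zb = PathIn-last-step w c≢b (keep c (PathIn-source w) c≢b) keep
    in z , move t'a ac w' , zb

  module _ (S : Sub n) (r : V) where

    Rest : List V → Sub n
    Rest P = S ∖ (_∈ᵇ P)

    Balanced : List V → Set
    Balanced P = ∀ u → Rest P u ≡ true → 2 * count (component (Rest P) u) ≤ count S

    record RootedPath (P : List V) : Set where
      field
        unique : Unique P
        inside : ∀ x → x ∈ P → S x ≡ true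
        linked : Linked Adj P
        from-r : ∃ λ ys → P ≡ r ∷ ys

    Rest-∷ʳ : ∀ P y z → Rest (P ∷ʳ y) z ≡ Rest P z ∧ not (eqᵇ z y)
    Rest-∷ʳ P y z = trans (cong (λ b → S z ∧ not b) (∈ᵇ-∷ʳ z P y)) (∧-not-∨ (S z) (z ∈ᵇ P) (eqᵇ z y))
      where
      ∧-not-∨ : ∀ s e q → s ∧ not (e ∨ q) ≡ (s ∧ not e) ∧ not q
      ∧-not-∨ true  true  q = refl
      ∧-not-∨ true  false q = refl
      ∧-not-∨ false e     q = refl

    Rest-∷ʳ-⊆ : ∀ P y → Rest (P ∷ʳ y) ⊆ Rest P
    Rest-∷ʳ-⊆ P y z p = ∧-elimˡ (Rest P z) (trans (sym (Rest-∷ʳ P y z)) p)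

    Rest-∷ʳ-keep : ∀ P y z → Rest P z ≡ true → z ≢ y → Rest (P ∷ʳ y) z ≡ true
    Rest-∷ʳ-keep P y z t z≢y rewrite Rest-∷ʳ P y z | t | eqᵇ-≢ z≢y = refl

    Rest-∷ʳ-drop : ∀ P y → Rest (P ∷ʳ y) y ≡ false
    Rest-∷ʳ-drop P y rewrite Rest-∷ʳ P y y | eqᵇ-refl y = ∧-zeroʳ (Rest P y)

    Rest-∉ : ∀ P y → Rest P y ≡ true → y ∉ P
    Rest-∉ P y t m = ∖-disjoint S (_∈ᵇ P) y t (∈ᵇ-complete m)

    Big : List V → V → Set
    Big P u = Rest P u ≡ true × count S < 2 * count (component (Rest P) u)

    big? : ∀ P u → Dec (Big P u)
    big? P u = (Rest P u Bool.≟ true) ×-dec (count S <? 2 * count (component (Rest P) u))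

    NextToBig : List V → V → Set
    NextToBig P x = ∀ u → Big P u → ∃ λ y → component (Rest P) u y ≡ true × Adj x y

    -- A big component of S ∖ (P ∷ʳ y) meets the old big component, which contains y.
    NextToBig-∷ʳ : ∀ P u y → Big P u → component (Rest P) u y ≡ true → NextToBig (P ∷ʳ y) y
    NextToBig-∷ʳ P u y (_ , big) cy u' (t'u' , big') =
      let z , u'→z , zy = PathIn-last-step u'→y u'≢y t'u' (Rest-∷ʳ-keep P y)
      in z , PathIn-component (Rest (P ∷ʳ y)) u' z u'→z , trans (adj-sym G y z) zy
      where
      T = Rest P
      bigT : count S < 2 * count (component T u')
      bigT = ≤-trans big' (*-monoʳ-≤ 2 (count-mono _ _ (component-mono (Rest-∷ʳ-⊆ P y) u')))
      u'→y : PathIn T u' y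
      u'→y =
        let m , cm , cm' = big-components-meet S T u u' (∖-⊆ S _) big bigT
        in PathIn-trans (component-PathIn T u' m cm')
             (PathIn-trans (PathIn-sym (component-PathIn T u m cm)) (component-PathIn T u y cy))
      u'≢y : u' ≢ y
      u'≢y refl = false≢true (trans (sym (Rest-∷ʳ-drop P y)) t'u')

    RootedPath-∷ʳ : ∀ Q x y → RootedPath (Q ∷ʳ x) → Rest (Q ∷ʳ x) y ≡ true → Adj x y →
                    RootedPath (Q ∷ʳ x ∷ʳ y)
    RootedPath-∷ʳ Q x y rp t xy = record
      { unique = Unique-∷ʳ unique (Rest-∉ (Q ∷ʳ x) y t)
      ; inside = inside′
      ; linked = Linked-∷ʳ Q linked xy
      ; from-r = proj₁ from-r ∷ʳ y , cong (_∷ʳ y) (proj₂ from-r) }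
      where
      open RootedPath rp
      inside′ : ∀ z → z ∈ Q ∷ʳ x ∷ʳ y → S z ≡ true
      inside′ z m with ∈-++⁻ (Q ∷ʳ x) m
      ... | inj₁ m'        = inside z m'
      ... | inj₂ (here refl) = ∧-elimˡ (S y) t

    record BalancedPath : Set where
      field
        P : List V
        rooted : RootedPath P
        balanced : Balanced P

    -- Walk into the big component, if any; S ∖ P shrinks at every step.
    extend : ∀ (fuel : ℕ) Q x → count (Rest (Q ∷ʳ x)) ≤ fuel →
             RootedPath (Q ∷ʳ x) → NextToBig (Q ∷ʳ x) x → BalancedPath
    extend fuel Q x bound rp next with any? (big? (Q ∷ʳ x))
    ... | no none = record { P = Q ∷ʳ x ; rooted = rp ; balanced = λ u t → ≮⇒≥ (λ lt → none (u , t , lt)) }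
    ... | yes (u , big) with next u big
    ... | y , cy , xy with fuel
    ...   | zero = ⊥-elim (<-irrefl refl (≤-trans (count-pos _ u (proj₁ big)) bound))
    ...   | suc fuel' =
      extend fuel' (Q ∷ʳ x) y bound' (RootedPath-∷ʳ Q x y rp ty xy) (NextToBig-∷ʳ (Q ∷ʳ x) u y big cy)
      where
      ty = component-⊆ (Rest (Q ∷ʳ x)) u y cy
      bound' : count (Rest (Q ∷ʳ x ∷ʳ y)) ≤ fuel'
      bound' = ≤-pred (≤-trans (count-monoˢ _ _ (Rest-∷ʳ-⊆ (Q ∷ʳ x) y) y ty (Rest-∷ʳ-drop (Q ∷ʳ x) y)) bound)

    -- Initially S itself is the big component of S ∖ [], and r lies in it.
    balanced-path : Connected-within S → S r ≡ true → BalancedPath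
    balanced-path conn sr =
      extend (count S) [] r (count-mono _ _ (∖-⊆ S _)) rooted (NextToBig-∷ʳ [] r r (tr , big) (component-self _ r tr))
      where
      S⊆Rest[] : S ⊆ Rest []
      S⊆Rest[] z s rewrite s = refl
      tr = S⊆Rest[] r sr
      big : count S < 2 * count (component (Rest []) r)
      big = begin-strict
        count S                             <⟨ m<m+n (count S) (count-pos S r sr) ⟩
        count S + count S                   ≡⟨ cong (count S +_) (sym (+-identityʳ (count S))) ⟩
        2 * count S                         ≤⟨ *-monoʳ-≤ 2 (count-mono _ _ λ z sz →
                                                 PathIn-component _ r z (PathIn-mono S⊆Rest[] (conn r z sr sz))) ⟩
        2 * count (component (Rest []) r) ∎
        where open ≤-Reasoning
      rooted : RootedPath [ r ]
      rooted = record { unique = [] ∷ [] ; inside = λ { z (here refl) → sr } ; linked = [-] ; from-r = [] , refl }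

-- Decompositions into runs

module Decompositions {n : ℕ} (G : Graph n) where
  open Components G
  open BalancedPaths G

  Infix : List V → List V → Set
  Infix r L = ∃₂ λ xs ys → L ≡ xs ++ r ++ ys

  Run : List V → List V → Set
  Run L r = (∃₂ λ x xs → r ≡ x ∷ xs) × Linked Adj r × Infix r L

  Run-extendʳ : ∀ L₁ L₂ r → Run L₁ r → Run (L₁ ++ L₂) r
  Run-extendʳ L₁ L₂ r (ne , lk , xs , ys , e) = ne , lk , xs , ys ++ L₂ ,
    trans (cong (_++ L₂) e) (trans (++-assoc xs (r ++ ys) L₂) (cong (xs ++_) (++-assoc r ys L₂)))

  Run-extendˡ : ∀ L₁ L₂ r → Run L₂ r → Run (L₁ ++ L₂) r
  Run-extendˡ L₁ L₂ r (ne , lk , xs , ys , e) = ne , lk , L₁ ++ xs , ys ,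
    trans (cong (L₁ ++_) e) (sym (++-assoc L₁ xs (r ++ ys)))

  SplitIntoRuns : List V → ℕ → List V → Set
  SplitIntoRuns L B c = Σ (List (List V)) λ rs → concat rs ≡ c × All (Run L) rs × 2 ^ length rs ≤ B

  -- chain v is the root-to-v list of ancestors of v.
  record Decomposition (T : Sub n) (B : ℕ) : Set where
    field
      order        : List V
      order-unique : Unique order
      order-⊆      : ∀ x → x ∈ order → T x ≡ true
      order-⊇      : ∀ x → T x ≡ true → x ∈ order
      chain        : V → List V
      chain-⊆      : ∀ v → T v ≡ true → ∀ x → x ∈ chain v → T x ≡ true
      chain-unique : ∀ v → T v ≡ true → Unique (chain v)
      chain-last   : ∀ v → T v ≡ true → ∃ λ xs → chain v ≡ xs ∷ʳ v
      chain-prefix : ∀ v xs a zs → T v ≡ true → chain v ≡ xs ++ a ∷ zs → chain a ≡ xs ∷ʳ a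
      chain-edge   : ∀ u v → T u ≡ true → T v ≡ true → adj G u v ≡ true → u ∈ chain v ⊎ v ∈ chain u
      runs         : ∀ v → T v ≡ true → SplitIntoRuns order B (chain v)

  record RootedDecomposition (S : Sub n) : Set where
    field
      decomposition : Decomposition S (2 * count S)
      root-vertex   : V
      chain-root    : ∀ v → S v ≡ true → ∃ λ ys → Decomposition.chain decomposition v ≡ root-vertex ∷ ys

  relax-bound : ∀ {T B B'} → Decomposition T B → B ≤ B' → Decomposition T B'
  relax-bound D B≤B' = record
    { order = order ; order-unique = order-unique ; order-⊆ = order-⊆ ; order-⊇ = order-⊇
    ; chain = chain ; chain-⊆ = chain-⊆ ; chain-unique = chain-unique ; chain-last = chain-last
    ; chain-prefix = chain-prefix ; chain-edge = chain-edge
    ; runs = λ v t → let rs , c , g , b = runs v t in rs , c , g , ≤-trans b B≤B' }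
    where open Decomposition D

  empty-decomposition : ∀ T B → (∀ x → T x ≡ false) → Decomposition T B
  empty-decomposition T B empty = record
    { order = [] ; order-unique = [] ; order-⊆ = λ x () ; order-⊇ = λ x t → ⊥-elim (absurd t)
    ; chain = λ _ → [] ; chain-⊆ = λ v t → ⊥-elim (absurd t) ; chain-unique = λ v t → ⊥-elim (absurd t)
    ; chain-last = λ v t → ⊥-elim (absurd t) ; chain-prefix = λ v xs a zs t → ⊥-elim (absurd t)
    ; chain-edge = λ u v t → ⊥-elim (absurd t) ; runs = λ v t → ⊥-elim (absurd t) }
    where
    absurd : ∀ {x} → T x ≡ true → ⊥
    absurd {x} t = false≢true (trans (sym (empty x)) t)

  module Union (T C : Sub n) (C⊆T : C ⊆ T) (closed : ClosedIn C T) {B : ℕ}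
               (DC : Decomposition C B) (DR : Decomposition (T ∖ C) B) where
    private
      module DC = Decomposition DC
      module DR = Decomposition DR

    R = T ∖ C

    order : List V
    order = DC.order ++ DR.order

    chain : V → List V
    chain v = if C v then DC.chain v else DR.chain v

    chain-C : ∀ v → C v ≡ true → chain v ≡ DC.chain v
    chain-C v c rewrite c = refl

    chain-R : ∀ v → C v ≡ false → chain v ≡ DR.chain v
    chain-R v c rewrite c = refl

    R-intro : ∀ x → T x ≡ true → C x ≡ false → R x ≡ true
    R-intro = ∖-intro T C

    order-⊆ : ∀ x → x ∈ order → T x ≡ true
    order-⊆ x m with ∈-++⁻ DC.order m
    ... | inj₁ a = C⊆T x (DC.order-⊆ x a)
    ... | inj₂ b = ∖-⊆ T C x (DR.order-⊆ x b)

    order-⊇ : ∀ x → T x ≡ true → x ∈ order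
    order-⊇ x t with C x in c
    ... | true  = ∈-++⁺ˡ (DC.order-⊇ x c)
    ... | false = ∈-++⁺ʳ DC.order (DR.order-⊇ x (R-intro x t c))

    chain-⊆ : ∀ v → T v ≡ true → ∀ x → x ∈ chain v → T x ≡ true
    chain-⊆ v t x m with C v in c
    ... | true  = C⊆T x (DC.chain-⊆ v c x m)
    ... | false = ∖-⊆ T C x (DR.chain-⊆ v (R-intro v t c) x m)

    chain-unique : ∀ v → T v ≡ true → Unique (chain v)
    chain-unique v t with C v in c
    ... | true  = DC.chain-unique v c
    ... | false = DR.chain-unique v (R-intro v t c)

    chain-last : ∀ v → T v ≡ true → ∃ λ xs → chain v ≡ xs ∷ʳ v
    chain-last v t with C v in c
    ... | true  = DC.chain-last v c
    ... | false = DR.chain-last v (R-intro v t c)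

    chain-prefix : ∀ v xs a zs → T v ≡ true → chain v ≡ xs ++ a ∷ zs → chain a ≡ xs ∷ʳ a
    chain-prefix v xs a zs t e with C v in c
    ... | true  = trans (chain-C a (DC.chain-⊆ v c a a∈)) (DC.chain-prefix v xs a zs c e)
      where a∈ = subst (a ∈_) (sym e) (∈-++⁺ʳ xs (here refl))
    ... | false = trans (chain-R a ca) (DR.chain-prefix v xs a zs r e)
      where
      r = R-intro v t c
      ra = DR.chain-⊆ v r a (subst (a ∈_) (sym e) (∈-++⁺ʳ xs (here refl)))
      ca : C a ≡ false
      ca = ¬-not (∖-disjoint T C a ra)

    chain-edge : ∀ a b → T a ≡ true → T b ≡ true → adj G a b ≡ true → a ∈ chain b ⊎ b ∈ chain a
    chain-edge a b ta tb ab with C a in ca | C b in cb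
    ... | true  | true  = DC.chain-edge a b ca cb ab
    ... | false | false = DR.chain-edge a b (R-intro a ta ca) (R-intro b tb cb) ab
    ... | true  | false = ⊥-elim (false≢true (trans (sym cb) (closed a b ca tb ab)))
    ... | false | true  = ⊥-elim (false≢true (trans (sym ca) (closed b a cb ta (trans (adj-sym G b a) ab))))

    runs : ∀ v → T v ≡ true → SplitIntoRuns order B (chain v)
    runs v t with C v in c
    ... | true  = let rs , cc , g , b = DC.runs v c
                  in rs , cc , All.map (λ {r} → Run-extendʳ DC.order DR.order r) g , b
    ... | false = let rs , cc , g , b = DR.runs v (R-intro v t c)
                  in rs , cc , All.map (λ {r} → Run-extendˡ DC.order DR.order r) g , b

  Decomposition-∪ : ∀ T C → C ⊆ T → ClosedIn C T → ∀ {B} → Decomposition C B → Decomposition (T ∖ C) B →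
                    Decomposition T B
  Decomposition-∪ T C C⊆T closed DC DR = record
    { order = order
    ; order-unique = Unique.++⁺ DC.order-unique DR.order-unique
        λ (m , m') → ∖-disjoint T C _ (DR.order-⊆ _ m') (DC.order-⊆ _ m)
    ; order-⊆ = order-⊆ ; order-⊇ = order-⊇ ; chain = chain ; chain-⊆ = chain-⊆
    ; chain-unique = chain-unique ; chain-last = chain-last ; chain-prefix = chain-prefix
    ; chain-edge = chain-edge ; runs = runs }
    where
    open Union T C C⊆T closed DC DR
    module DC = Decomposition DC
    module DR = Decomposition DR

  module PathFirst (S : Sub n) (r : V) (BP : BalancedPath S r)
                   (DR : Decomposition (Rest S r (BalancedPath.P BP)) (count S)) where
    open BalancedPath BP
    open RootedPath rooted
    private module DR = Decomposition DR

    R = Rest S r P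

    R-intro : ∀ x → S x ≡ true → x ∈ᵇ P ≡ false → R x ≡ true
    R-intro = ∖-intro S (_∈ᵇ P)

    R-∉ : ∀ {x} → R x ≡ true → x ∈ᵇ P ≡ true → ⊥
    R-∉ {x} = ∖-disjoint S (_∈ᵇ P) x

    order : List V
    order = P ++ DR.order

    chain : V → List V
    chain v = if v ∈ᵇ P then takeThrough v P else P ++ DR.chain v

    chain-P : ∀ v → v ∈ᵇ P ≡ true → chain v ≡ takeThrough v P
    chain-P v e rewrite e = refl

    chain-R : ∀ v → v ∈ᵇ P ≡ false → chain v ≡ P ++ DR.chain v
    chain-R v e rewrite e = refl

    chain-split : ∀ b ys zs → P ≡ ys ++ b ∷ zs → chain b ≡ ys ∷ʳ b
    chain-split b ys zs eq =
      trans (chain-P b (∈ᵇ-complete (subst (b ∈_) (sym eq) (∈-++⁺ʳ ys (here refl)))))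
            (trans (cong (takeThrough b) eq) (takeThrough-++ ys b zs (subst Unique eq unique)))

    split : ∀ v → v ∈ᵇ P ≡ true → ∃₂ λ ys zs → P ≡ ys ++ v ∷ zs
    split v e = ∈-∃++ (∈ᵇ-sound v P e)

    order-⊆ : ∀ x → x ∈ order → S x ≡ true
    order-⊆ x m with ∈-++⁻ P m
    ... | inj₁ a = inside x a
    ... | inj₂ b = ∖-⊆ S (_∈ᵇ P) x (DR.order-⊆ x b)

    order-⊇ : ∀ x → S x ≡ true → x ∈ order
    order-⊇ x s with x ∈ᵇ P in e
    ... | true  = ∈-++⁺ˡ (∈ᵇ-sound x P e)
    ... | false = ∈-++⁺ʳ P (DR.order-⊇ x (R-intro x s e))

    chain-⊆ : ∀ v → S v ≡ true → ∀ x → x ∈ chain v → S x ≡ true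
    chain-⊆ v s x m with v ∈ᵇ P in e
    ... | true = let ys , zs , eq = split v e in
      inside x (subst (x ∈_) (sym (trans eq (sym (∷ʳ-++ ys v zs))))
                 (∈-++⁺ˡ (subst (x ∈_) (chain-split v ys zs eq) (subst (x ∈_) (sym (chain-P v e)) m))))
    ... | false with ∈-++⁻ P m
    ...   | inj₁ a = inside x a
    ...   | inj₂ b = ∖-⊆ S (_∈ᵇ P) x (DR.chain-⊆ v (R-intro v s e) x b)

    chain-unique : ∀ v → S v ≡ true → Unique (chain v)
    chain-unique v s with v ∈ᵇ P in e
    ... | true = let ys , zs , eq = split v e in
      subst Unique (trans (sym (chain-split v ys zs eq)) (chain-P v e))
        (AllPairs-++⁻ˡ (ys ∷ʳ v) (subst Unique (trans eq (sym (∷ʳ-++ ys v zs))) unique))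
    ... | false = Unique.++⁺ unique (DR.chain-unique v t) λ (m , m') → R-∉ (DR.chain-⊆ v t _ m') (∈ᵇ-complete m)
      where t = R-intro v s e

    chain-last : ∀ v → S v ≡ true → ∃ λ xs → chain v ≡ xs ∷ʳ v
    chain-last v s with v ∈ᵇ P in e
    ... | true = let ys , zs , eq = split v e in ys , trans (sym (chain-P v e)) (chain-split v ys zs eq)
    ... | false = let ys , eq = DR.chain-last v (R-intro v s e) in
      P ++ ys , trans (cong (P ++_) eq) (sym (++-assoc P ys (v ∷ [])))

    chain-prefix : ∀ v xs a zs → S v ≡ true → chain v ≡ xs ++ a ∷ zs → chain a ≡ xs ∷ʳ a
    chain-prefix v xs a zs s e with v ∈ᵇ P in p
    ... | true = let ys , ws , eq = split v p in chain-split a xs (zs ++ ws) (begin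
      P                    ≡⟨ trans eq (sym (∷ʳ-++ ys v ws)) ⟩
      (ys ∷ʳ v) ++ ws      ≡⟨ cong (_++ ws) (trans (sym (chain-split v ys ws eq)) (trans (chain-P v p) e)) ⟩
      (xs ++ a ∷ zs) ++ ws ≡⟨ ++-assoc xs (a ∷ zs) ws ⟩
      xs ++ a ∷ zs ++ ws   ∎)
      where open ≡-Reasoning
    ... | false with ++-∷-split P (DR.chain v) xs e
    ...   | inj₁ (ws , eq) = chain-split a xs ws eq
    ...   | inj₂ (xs' , refl , eR) = begin
      chain a         ≡⟨ chain-R a (¬-not (R-∉ ra)) ⟩
      P ++ DR.chain a ≡⟨ cong (P ++_) (DR.chain-prefix v xs' a zs t eR) ⟩
      P ++ (xs' ∷ʳ a) ≡⟨ sym (++-assoc P xs' (a ∷ [])) ⟩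
      (P ++ xs') ∷ʳ a ∎
      where
      open ≡-Reasoning
      t = R-intro v s p
      ra = DR.chain-⊆ v t a (subst (a ∈_) (sym eR) (∈-++⁺ʳ xs' (here refl)))

    chain-edge-P : ∀ a b → a ∈ᵇ P ≡ true → b ∈ᵇ P ≡ true → a ∈ chain b ⊎ b ∈ chain a
    chain-edge-P a b ea eb with split a ea
    ... | xs , zs , eqP with ∈-++⁻ xs (subst (b ∈_) eqP (∈ᵇ-sound b P eb))
    ...   | inj₁ bx = inj₂ (subst (b ∈_) (sym (chain-split a xs zs eqP)) (∈-++⁺ˡ bx))
    ...   | inj₂ (here refl) = inj₂ (subst (b ∈_) (sym (chain-split a xs zs eqP)) (∈-++⁺ʳ xs (here refl)))
    ...   | inj₂ (there bz) =
      let zs₁ , zs₂ , eqz = ∈-∃++ bz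
          eqP' = trans eqP (trans (cong (λ z → xs ++ a ∷ z) eqz) (sym (++-assoc xs (a ∷ zs₁) (b ∷ zs₂))))
      in inj₁ (subst (a ∈_) (sym (chain-split b (xs ++ a ∷ zs₁) zs₂ eqP')) (∈-++⁺ˡ (∈-++⁺ʳ xs (here refl))))

    chain-edge : ∀ a b → S a ≡ true → S b ≡ true → adj G a b ≡ true → a ∈ chain b ⊎ b ∈ chain a
    chain-edge a b sa sb ab = by-cases (a ∈ᵇ P) (b ∈ᵇ P) refl refl
      where
      by-cases : ∀ α β → a ∈ᵇ P ≡ α → b ∈ᵇ P ≡ β → a ∈ chain b ⊎ b ∈ chain a
      by-cases true  true  ea eb = chain-edge-P a b ea eb
      by-cases true  false ea eb = inj₁ (subst (a ∈_) (sym (chain-R b eb)) (∈-++⁺ˡ (∈ᵇ-sound a P ea)))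
      by-cases false true  ea eb = inj₂ (subst (b ∈_) (sym (chain-R a ea)) (∈-++⁺ˡ (∈ᵇ-sound b P eb)))
      by-cases false false ea eb with DR.chain-edge a b (R-intro a sa ea) (R-intro b sb eb) ab
      ... | inj₁ m = inj₁ (subst (a ∈_) (sym (chain-R b eb)) (∈-++⁺ʳ P m))
      ... | inj₂ m = inj₂ (subst (b ∈_) (sym (chain-R a ea)) (∈-++⁺ʳ P m))

    path-run : ∀ ys v zs → P ≡ ys ++ v ∷ zs → Run order (ys ∷ʳ v)
    path-run ys v zs eqP =
      nonempty ys , Linked-++⁻ˡ (ys ∷ʳ v) (subst (Linked Adj) P≡ linked) ,
      [] , zs ++ DR.order , trans (cong (_++ DR.order) P≡) (++-assoc (ys ∷ʳ v) zs DR.order)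
      where
      P≡ = trans eqP (sym (∷ʳ-++ ys v zs))
      nonempty : ∀ ys → ∃₂ λ x xs → ys ∷ʳ v ≡ x ∷ xs
      nonempty []       = v , [] , refl
      nonempty (y ∷ ys) = y , ys ∷ʳ v , refl

    whole-path-run : Run order P
    whole-path-run = (r , from-r) , linked , [] , DR.order , refl

    runs : 0 < count S → ∀ v → S v ≡ true → SplitIntoRuns order (2 * count S) (chain v)
    runs S≢∅ v s with v ∈ᵇ P in e
    ... | true = let ys , zs , eq = split v e in
      [ ys ∷ʳ v ] , trans (++-identityʳ _) (trans (sym (chain-split v ys zs eq)) (chain-P v e)) ,
      path-run ys v zs eq ∷ [] , *-monoʳ-≤ 2 S≢∅
    ... | false = let rs , c , g , b = DR.runs v (R-intro v s e) in
      P ∷ rs , cong (P ++_) c ,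
      whole-path-run ∷ All.map (λ {r'} → Run-extendˡ P DR.order r') g , *-monoʳ-≤ 2 b

    chain-root : ∀ v → S v ≡ true → ∃ λ ys → chain v ≡ r ∷ ys
    chain-root v s with v ∈ᵇ P
    ... | true  = subst (λ Q → ∃ λ ys → takeThrough v Q ≡ r ∷ ys) (sym (proj₂ from-r))
                        (takeThrough-head v r (proj₁ from-r))
    ... | false = proj₁ from-r ++ DR.chain v , cong (_++ DR.chain v) (proj₂ from-r)

  Decomposition-path : ∀ S r (BP : BalancedPath S r) → Decomposition (Rest S r (BalancedPath.P BP)) (count S) →
                       0 < count S → RootedDecomposition S
  Decomposition-path S r BP DR S≢∅ = record
    { decomposition = record
      { order = order
      ; order-unique = Unique.++⁺ unique DR.order-unique
          λ (m , m') → R-∉ (DR.order-⊆ _ m') (∈ᵇ-complete m)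
      ; order-⊆ = order-⊆ ; order-⊇ = order-⊇ ; chain = chain ; chain-⊆ = chain-⊆
      ; chain-unique = chain-unique ; chain-last = chain-last ; chain-prefix = chain-prefix
      ; chain-edge = chain-edge ; runs = runs S≢∅ }
    ; root-vertex = r
    ; chain-root = chain-root }
    where
    open PathFirst S r BP DR
    open BalancedPath BP
    open RootedPath rooted
    module DR = Decomposition DR

  -- Components of S ∖ P have at most half of the vertices of S, so one run per level keeps 2^runs ≤ 2 |S|.
  mutual
    decompose-connected : ∀ fuel S r → Connected-within S → S r ≡ true → count S ≤ fuel → RootedDecomposition S
    decompose-connected zero S r _ sr bound = ⊥-elim (<-irrefl refl (≤-trans (count-pos S r sr) bound))
    decompose-connected (suc fuel) S r conn sr bound =
      Decomposition-path S r BP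
        (decompose-balanced fuel (count (Rest S r P)) (Rest S r P) (count S) balanced bound ≤-refl)
        (count-pos S r sr)
      where
      BP = balanced-path S r conn sr
      open BalancedPath BP

    decompose-balanced : ∀ fuel size T B → (∀ u → T u ≡ true → 2 * count (component T u) ≤ B) →
                         B ≤ suc fuel → count T ≤ size → Decomposition T B
    decompose-balanced fuel size T B small B≤ bound with any? (λ u → T u Bool.≟ true)
    ... | no none = empty-decomposition T B (λ x → ¬-not (λ t → none (x , t)))
    ... | yes (u , tu) with size
    ...   | zero = ⊥-elim (<-irrefl refl (≤-trans (count-pos T u tu) bound))
    ...   | suc size' =
      Decomposition-∪ T C (component-⊆ T u) (component-closed T u)
        (relax-bound (RootedDecomposition.decomposition
           (decompose-connected fuel C u (component-connected T u) cu C≤fuel)) (small u tu))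
        (decompose-balanced fuel size' (T ∖ C) B small' B≤ bound')
      where
      C = component T u
      cu = component-self T u tu
      C≤fuel : count C ≤ fuel
      C≤fuel = half-≤ _ fuel (≤-trans (small u tu) B≤) (count-pos C u cu)
      small' : ∀ u' → (T ∖ C) u' ≡ true → 2 * count (component (T ∖ C) u') ≤ B
      small' u' t' = ≤-trans (*-monoʳ-≤ 2 (count-mono _ _ (component-mono (∖-⊆ T C) u')))
                             (small u' (∖-⊆ T C u' t'))
      bound' : count (T ∖ C) ≤ size'
      bound' = ≤-pred (≤-trans (count-monoˢ _ _ (∖-⊆ T C) u tu (∖-excludes T C u cu)) bound)

-- Coding runs of points

digit-% : ∀ a K b .{{_ : NonZero b}} → a < b → (a + K * b) % b ≡ a
digit-% a K b a<b = trans ([m+kn]%n≡m%n a K b) (m<n⇒m%n≡m a<b)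

digit-/ : ∀ a K b .{{_ : NonZero b}} → a < b → (a + K * b) / b ≡ K
digit-/ a K b a<b = trans (+-distrib-/-∣ʳ a (n∣m*n K)) (cong₂ _+_ (m<n⇒m/n≡0 a<b) (m*n/n≡m K b))

digit-< : ∀ a K K' b → a < b → K < K' → a + K * b < K' * b
digit-< a K K' b a<b K<K' = begin-strict
  a + K * b  <⟨ +-monoˡ-< (K * b) a<b ⟩
  b + K * b  ≤⟨ *-monoˡ-≤ b K<K' ⟩
  K' * b     ∎
  where open ≤-Reasoning

-- Runs of points (index, distance) in which the index grows by one and the distance changes by at
-- most one from point to point; they are written as digits of a mixed-radix number.
module RunCode (base : ℕ) .{{_ : NonZero base}} where

  Point : Set
  Point = ℕ × ℕ

  data ValidTail : ℕ → ℕ → List Point → Set where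
    []  : ∀ {i d} → ValidTail i d []
    _∷_ : ∀ {i d d' ps} → d' ≤ suc d × d ≤ suc d' → ValidTail (suc i) d' ps → ValidTail i d ((suc i , d') ∷ ps)

  data ValidRuns : List (List Point) → Set where
    []   : ValidRuns []
    _∷_  : ∀ {i d ps rs} → (i < base × d < base × length ps < base) × ValidTail i d ps → ValidRuns rs →
           ValidRuns (((i , d) ∷ ps) ∷ rs)

  -- d' − d + 1 ∈ {0, 1, 2}; the truncated subtraction is exact on valid tails.
  trit : ℕ → ℕ → ℕ
  trit d d' = d' + 1 ∸ d

  encodeTail : ℕ → List Point → ℕ → ℕ
  encodeTail d []              K = K
  encodeTail d ((_ , d') ∷ ps) K = trit d d' + encodeTail d' ps K * 3

  encode : List (List Point) → ℕ
  encode []                    = 0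
  encode ([] ∷ rs)             = 0
  encode (((i , d) ∷ ps) ∷ rs) = 1 + (i + (d + (length ps + encodeTail d ps (encode rs) * base) * base) * base) * 2

  decodeTail : ℕ → ℕ → ℕ → ℕ → List Point × ℕ
  decodeTail zero    i d N = [] , N
  decodeTail (suc l) i d N =
    let d' = d + N % 3 ∸ 1
        ps , N' = decodeTail l (suc i) d' (N / 3)
    in (suc i , d') ∷ ps , N'

  decode : ℕ → ℕ → List Point
  decode zero       N = []
  decode (suc fuel) N =
    if N % 2 ≡ᵇ 0 then [] else
    let N₁ = N / 2
        N₂ = N₁ / base
        N₃ = N₂ / base
        i = N₁ % base
        d = N₂ % base
        l = N₃ % base
        ps , N₄ = decodeTail l i d (N₃ / base)
    in ((i , d) ∷ ps) ++ decode fuel N₄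

  trit-valid : ∀ d d' → d' ≤ suc d × d ≤ suc d' → trit d d' < 3 × d + trit d d' ∸ 1 ≡ d'
  trit-valid d d' (d'≤ , d≤) =
    s≤s (subst (trit d d' ≤_) (m+n∸m≡n d 2)
           (∸-monoˡ-≤ d (subst (d' + 1 ≤_) (sym (+-suc d 1)) (+-monoˡ-≤ 1 d'≤)))) ,
    trans (cong (_∸ 1) (m+[n∸m]≡n (subst (d ≤_) (+-comm 1 d') d≤))) (m+n∸n≡m d' 1)

  decodeTail-encodeTail : ∀ i d ps K → ValidTail i d ps → decodeTail (length ps) i d (encodeTail d ps K) ≡ (ps , K)
  decodeTail-encodeTail i d [] K [] = refl
  decodeTail-encodeTail i d ((.(suc i) , d') ∷ ps) K (near ∷ v)
    rewrite digit-% (trit d d') (encodeTail d' ps K) 3 (proj₁ (trit-valid d d' near))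
          | digit-/ (trit d d') (encodeTail d' ps K) 3 (proj₁ (trit-valid d d' near))
          | proj₂ (trit-valid d d' near)
          | decodeTail-encodeTail (suc i) d' ps K v = refl

  decode-encode : ∀ fuel rs → ValidRuns rs → length rs ≤ fuel → decode fuel (encode rs) ≡ concat rs
  decode-encode zero       [] [] _ = refl
  decode-encode (suc fuel) [] [] _ = refl
  decode-encode (suc fuel) (((i , d) ∷ ps) ∷ rs) (((i< , d< , l<) , vt) ∷ vr) (s≤s le)
    rewrite digit-% 1 (i + (d + (length ps + encodeTail d ps (encode rs) * base) * base) * base) 2 (s≤s (s≤s z≤n))
          | digit-/ 1 (i + (d + (length ps + encodeTail d ps (encode rs) * base) * base) * base) 2 (s≤s (s≤s z≤n))
          | digit-/ i (d + (length ps + encodeTail d ps (encode rs) * base) * base) base i<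
          | digit-% i (d + (length ps + encodeTail d ps (encode rs) * base) * base) base i<
          | digit-/ d (length ps + encodeTail d ps (encode rs) * base) base d<
          | digit-% d (length ps + encodeTail d ps (encode rs) * base) base d<
          | digit-/ (length ps) (encodeTail d ps (encode rs)) base l<
          | digit-% (length ps) (encodeTail d ps (encode rs)) base l<
          | decodeTail-encodeTail i d ps (encode rs) vt
          | decode-encode fuel rs vr le = refl

  encodeTail-< : ∀ i d ps K K' → ValidTail i d ps → K < K' → encodeTail d ps K < 3 ^ length ps * K'
  encodeTail-< i d [] K K' [] K<K' = subst (K <_) (sym (+-identityʳ K')) K<K'
  encodeTail-< i d ((_ , d') ∷ ps) K K' (near ∷ v) K<K' =
    subst (trit d d' + encodeTail d' ps K * 3 <_) (trans (*-comm (3 ^ length ps * K') 3) (sym (*-assoc 3 (3 ^ length ps) K')))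
      (digit-< _ _ _ 3 (proj₁ (trit-valid d d' near)) (encodeTail-< (suc i) d' ps K K' v K<K'))

  radix : ℕ
  radix = 2 * (base * (base * base))

  encode-< : ∀ rs → ValidRuns rs → encode rs < radix ^ length rs * 3 ^ length (concat rs)
  encode-< [] [] = s≤s z≤n
  encode-< (((i , d) ∷ ps) ∷ rs) (((i< , d< , l<) , vt) ∷ vr) = begin-strict
    encode (((i , d) ∷ ps) ∷ rs)
      <⟨ digit-< 1 _ _ 2 (s≤s (s≤s z≤n)) (digit-< i _ _ base i< (digit-< d _ _ base d< (digit-< (length ps) _ _ base l<
           (encodeTail-< i d ps (encode rs) X vt (encode-< rs vr))))) ⟩
    3 ^ l * X * base * base * base * 2
      ≡⟨ rearrange (3 ^ l) X base ⟩
    radix * (3 ^ l * X)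
      ≤⟨ *-monoʳ-≤ radix (*-monoˡ-≤ X (^-monoʳ-≤ 3 (n≤1+n l))) ⟩
    radix * (3 ^ suc l * (radix ^ q * 3 ^ L))
      ≡⟨ regroup radix (3 ^ suc l) (radix ^ q) (3 ^ L) ⟩
    radix ^ suc q * (3 ^ suc l * 3 ^ L)
      ≡⟨ cong (radix ^ suc q *_)
           (trans (sym (^-distribˡ-+-* 3 (suc l) L)) (cong (3 ^_) (sym (length-++ ((i , d) ∷ ps))))) ⟩
    radix ^ suc q * 3 ^ length (((i , d) ∷ ps) ++ concat rs) ∎
    where
    open ≤-Reasoning
    l = length ps
    q = length rs
    L = length (concat rs)
    X = radix ^ q * 3 ^ L
    rearrange : ∀ t x b → t * x * b * b * b * 2 ≡ 2 * (b * (b * b)) * (t * x)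
    rearrange = solve-∀
    regroup : ∀ m t p s → m * (t * (p * s)) ≡ m * p * (t * s)
    regroup = solve-∀

bits : ℕᵇ → List Bool
bits zero     = []
bits 2[1+ x ] = true ∷ bits x
bits 1+[2 x ] = false ∷ bits x

unbits : List Bool → ℕᵇ
unbits []          = zero
unbits (true ∷ bs)  = 2[1+ unbits bs ]
unbits (false ∷ bs) = 1+[2 unbits bs ]

unbits-bits : ∀ x → unbits (bits x) ≡ x
unbits-bits zero     = refl
unbits-bits 2[1+ x ] = cong 2[1+_] (unbits-bits x)
unbits-bits 1+[2 x ] = cong 1+[2_] (unbits-bits x)

2^length-bits : ∀ x → 2 ^ length (bits x) ≤ suc (ℕᵇ.toℕ x)
2^length-bits zero     = ≤-refl
2^length-bits 2[1+ x ] = ≤-trans (*-monoʳ-≤ 2 (2^length-bits x)) (n≤1+n _)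
2^length-bits 1+[2 x ] = ≤-trans (*-monoʳ-≤ 2 (2^length-bits x)) (≤-reflexive (*-suc 2 (ℕᵇ.toℕ x)))

2^∸-≤ : ∀ a E F X → 2 ^ a ≤ 2 ^ E * X → E ≤ F → 2 ^ (a ∸ F) ≤ X
2^∸-≤ a E F zero h _ = ⊥-elim (<-irrefl refl (≤-trans (m^n>0 2 a) (≤-trans h (≤-reflexive (*-zeroʳ (2 ^ E))))))
2^∸-≤ a E F (suc X) h E≤F with a ≤? F
... | yes a≤F rewrite m≤n⇒m∸n≡0 a≤F = s≤s z≤n
... | no a≰F = *-cancelˡ-≤ (2 ^ F) {{m^n≢0 2 F}} (begin
  2 ^ F * 2 ^ (a ∸ F) ≡⟨ sym (^-distribˡ-+-* 2 F (a ∸ F)) ⟩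
  2 ^ (F + (a ∸ F))   ≡⟨ cong (2 ^_) (m+[n∸m]≡n (<⇒≤ (≰⇒> a≰F))) ⟩
  2 ^ a               ≤⟨ h ⟩
  2 ^ E * suc X       ≤⟨ *-monoˡ-≤ (suc X) (^-monoʳ-≤ 2 E≤F) ⟩
  2 ^ F * suc X       ∎)
  where open ≤-Reasoning

log-bound-poly : ∀ l → 1 ≤ l → (1 + 3 * (2 + l)) * (1 + l) ≤ 20 * l ^ 2
log-bound-poly (suc k) _ = subst₂ _≤_ (sym (lhs k)) (sym (rhs k)) (m≤m+n _ (17 * k * k + 24 * k))
  where
  lhs : ∀ k → (1 + 3 * (2 + (1 + k))) * (1 + (1 + k)) ≡ 3 * k * k + 16 * k + 20
  lhs = solve-∀
  rhs : ∀ k → 20 * ((1 + k) * ((1 + k) * 1)) ≡ 3 * k * k + 16 * k + 20 + (17 * k * k + 24 * k)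
  rhs = solve-∀

n<2^[1+log₂n] : ∀ n → n < 2 ^ suc ⌊log₂ n ⌋
n<2^[1+log₂n] n = ≰⇒> λ le →
  1+n≰n (subst (_≤ ⌊log₂ n ⌋) (⌊log₂[2^n]⌋≡n (suc ⌊log₂ n ⌋)) (⌊log₂⌋-mono-≤ le))

2^q≤2n⇒q≤1+log₂n : ∀ n q → 1 ≤ n → 2 ^ q ≤ 2 * n → q ≤ suc ⌊log₂ n ⌋
2^q≤2n⇒q≤1+log₂n (suc n) q _ h =
  subst₂ _≤_ (⌊log₂[2^n]⌋≡n q) (⌊log₂[2*b]⌋≡1+⌊log₂b⌋ (suc n)) (⌊log₂⌋-mono-≤ h)

-- With base n + 2, radix ≤ 2^k for k = 1 + 3 (2 + log n), and there are at most 1 + log n runs.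
label-length : ∀ n → 2 ≤ n → ∀ len N q L → 2 ^ len ≤ suc N →
               N < (2 * ((2 + n) * ((2 + n) * (2 + n)))) ^ q * 3 ^ L → L ≤ n → 2 ^ q ≤ 2 * n →
               2 ^ (len ∸ 20 * (⌊log₂ n ⌋ ^ 2)) ≤ 3 ^ n
label-length n 2≤n len N q L len≤ N< L≤n 2^q≤ =
  2^∸-≤ len (k * suc l) (20 * l ^ 2) (3 ^ n) len-bound (log-bound-poly l (⌊log₂⌋-mono-≤ 2≤n))
  where
  l = ⌊log₂ n ⌋
  a = 2 + l
  k = 1 + 3 * a
  base≤ : 2 + n ≤ 2 ^ a
  base≤ = begin
    2 + n                 ≤⟨ s≤s (n<2^[1+log₂n] n) ⟩
    1 + 2 ^ suc l         ≤⟨ +-monoˡ-≤ (2 ^ suc l) (m^n>0 2 (suc l)) ⟩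
    2 ^ suc l + 2 ^ suc l ≡⟨ cong (2 ^ suc l +_) (sym (+-identityʳ (2 ^ suc l))) ⟩
    2 ^ a                 ∎
    where open ≤-Reasoning
  radix≤ : 2 * ((2 + n) * ((2 + n) * (2 + n))) ≤ 2 ^ k
  radix≤ = begin
    2 * ((2 + n) * ((2 + n) * (2 + n))) ≤⟨ *-monoʳ-≤ 2 (*-mono-≤ base≤ (*-mono-≤ base≤ base≤)) ⟩
    2 * (2 ^ a * (2 ^ a * 2 ^ a))       ≡⟨ cong (λ z → 2 * (2 ^ a * (2 ^ a * z))) (sym (*-identityʳ (2 ^ a))) ⟩
    2 * (2 ^ a) ^ 3                     ≡⟨ cong (2 *_) (trans (^-*-assoc 2 a 3) (cong (2 ^_) (*-comm a 3))) ⟩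
    2 ^ k                               ∎
    where open ≤-Reasoning
  len-bound : 2 ^ len ≤ 2 ^ (k * suc l) * 3 ^ n
  len-bound = begin
    2 ^ len                                              ≤⟨ len≤ ⟩
    suc N                                                ≤⟨ N< ⟩
    (2 * ((2 + n) * ((2 + n) * (2 + n)))) ^ q * 3 ^ L    ≤⟨ *-mono-≤ (^-monoˡ-≤ q radix≤) (^-monoʳ-≤ 3 L≤n) ⟩
    (2 ^ k) ^ q * 3 ^ n                                  ≤⟨ *-monoˡ-≤ (3 ^ n) (^-monoʳ-≤ (2 ^ k) {{m^n≢0 2 k}}
                                                              (2^q≤2n⇒q≤1+log₂n n q (≤-trans (s≤s z≤n) 2≤n) 2^q≤)) ⟩
    (2 ^ k) ^ suc l * 3 ^ n                              ≡⟨ cong (_* 3 ^ n) (^-*-assoc 2 k (suc l)) ⟩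
    2 ^ (k * suc l) * 3 ^ n                              ∎
    where open ≤-Reasoning

module Distances {n : ℕ} (G : Graph n) where
  open Components G

  walk? : ∀ u v j → Dec (Walk G u v j)
  walk? u v zero with u ≟ v
  ... | yes refl = yes here
  ... | no u≢v   = no λ { here → u≢v refl }
  walk? u v (suc j) with any? (λ w → (adj G u w Bool.≟ true) ×-dec walk? w v j)
  ... | yes (w , a , wk) = yes (step a wk)
  ... | no none          = no λ { (step {w = w} a wk) → none (w , a , wk) }

  shortest-below : ∀ u v b → (Σ ℕ λ d → d < b × IsDist G u v d) ⊎ (∀ k → k < b → ¬ Walk G u v k)
  shortest-below u v zero = inj₂ (λ k ())
  shortest-below u v (suc b) with shortest-below u v b
  ... | inj₁ (d , d<b , isd) = inj₁ (d , m<n⇒m<1+n d<b , isd)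
  ... | inj₂ none with walk? u v b
  ...   | yes w  = inj₁ (b , ≤-refl , w , λ k wk → ≮⇒≥ (λ k<b → none k k<b wk))
  ...   | no ¬w = inj₂ λ k k<1+b wk → case (m≤n⇒m<n∨m≡n (≤-pred k<1+b)) wk
    where
    case : ∀ {k} → k < b ⊎ k ≡ b → Walk G u v k → ⊥
    case (inj₁ k<b) wk = none _ k<b wk
    case (inj₂ refl) wk = ¬w wk

  distance-≤-walk : ∀ {u v k} → Walk G u v k → Σ ℕ λ d → d ≤ k × IsDist G u v d
  distance-≤-walk {u} {v} {k} w with shortest-below u v (suc k)
  ... | inj₁ (d , d<1+k , isd) = d , ≤-pred d<1+k , isd
  ... | inj₂ none              = ⊥-elim (none k ≤-refl w)

  full : Sub n
  full _ = true

  walk-PathIn : ∀ {u v k} → Walk G u v k → PathIn full u v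
  walk-PathIn here       = done refl
  walk-PathIn (step a w) = move refl a (walk-PathIn w)

  module _ (conn : Connected G) where

    full-connected : Connected-within full
    full-connected x y _ _ = walk-PathIn (proj₂ (conn x y))

    distance : ∀ u v → Σ ℕ λ d → d ≤ suc n × IsDist G u v d
    distance u v =
      let j , j≤ , w = component-walk full u v (PathIn-component full u v (full-connected u v refl refl))
          d , d≤ , isd = distance-≤-walk w
      in d , ≤-trans d≤ j≤ , isd

    dist : V → V → ℕ
    dist u v = proj₁ (distance u v)

    dist-≤ : ∀ u v → dist u v ≤ suc n
    dist-≤ u v = proj₁ (proj₂ (distance u v))

    dist-IsDist : ∀ u v → IsDist G u v (dist u v)
    dist-IsDist u v = proj₂ (proj₂ (distance u v))

    dist-adj : ∀ v a b → adj G a b ≡ true → dist v b ≤ suc (dist v a)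
    dist-adj v a b ab = proj₂ (dist-IsDist v b) (suc (dist v a)) (walk-∷ʳ (proj₁ (dist-IsDist v a)) ab)

-- The labelling scheme

decoder : ℕ → List Bool → List ℕ × List ℕ
decoder n bs = let ps = RunCode.decode (2 + n) n (ℕᵇ.toℕ (unbits bs)) in map proj₁ ps , map proj₂ ps

module Labelling {n : ℕ} (G : Graph n) (conn : Connected G)
                 (RD : Decompositions.RootedDecomposition G (Distances.full G)) where
  open Components G
  open BalancedPaths G using (Adj)
  open Decompositions G
  open Distances G
  open RootedDecomposition RD
  open Decomposition decomposition

  parentOf : V → V
  parentOf v = penultimate v (chain v)

  chain-root-only : chain root-vertex ≡ [ root-vertex ]
  chain-root-only with chain-root root-vertex refl | chain-last root-vertex refl
  ... | ys , e₁ | [] , e₂ = e₂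
  ... | ys , e₁ | z ∷ zs , e₂ =
    ⊥-elim (Unique[x∷xs]⇒x∉xs (subst Unique e₁ (chain-unique root-vertex refl))
             (subst (root-vertex ∈_) (sym (proj₂ (∷-injective (trans (sym e₁) e₂)))) (∈-++⁺ʳ zs (here refl))))

  parentOf-root : parentOf root-vertex ≡ root-vertex
  parentOf-root rewrite chain-root-only = refl

  chain-parent : ∀ v → (chain v ≡ [ v ] × parentOf v ≡ v) ⊎ chain v ≡ chain (parentOf v) ∷ʳ v
  chain-parent v with chain-last v refl
  ... | xs , e with initLast xs
  ... | []        = inj₁ (e , cong (penultimate v) e)
  ... | ys ∷ʳ′ p = inj₂ (trans e (cong (_∷ʳ v) (sym chain-p)))
    where
    e' : chain v ≡ ys ++ p ∷ v ∷ []
    e' = trans e (++-assoc ys (p ∷ []) (v ∷ []))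
    chain-p : chain (parentOf v) ≡ ys ∷ʳ p
    chain-p = trans (cong chain (trans (cong (penultimate v) e') (penultimate-++ v ys p v)))
                    (chain-prefix v ys p (v ∷ []) refl e')

  length-chain-parent : ∀ v → chain v ≡ chain (parentOf v) ∷ʳ v → length (chain (parentOf v)) < length (chain v)
  length-chain-parent v e =
    subst (length (chain (parentOf v)) <_) (sym (cong length e)) (length-++-∷ (chain (parentOf v)) v [])

  ancestor⇒∈-chain : ∀ j v → iter parentOf j v ∈ chain v
  ancestor⇒∈-chain j v = go (length (chain v)) v ≤-refl j
    where
    go : ∀ fuel v → length (chain v) ≤ fuel → ∀ j → iter parentOf j v ∈ chain v
    go fuel v _ zero = let xs , e = chain-last v refl in subst (v ∈_) (sym e) (∈-++⁺ʳ xs (here refl))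
    go fuel v le (suc j) with chain-parent v
    ... | inj₁ (e , pv) = subst (_∈ chain v) (sym (iter-fixed parentOf (suc j) v pv)) (go fuel v le zero)
    ... | inj₂ e with fuel
    ...   | zero = ⊥-elim (n≮0 (≤-trans (length-chain-parent v e) le))
    ...   | suc fuel' =
      subst (_∈ chain v) (sym (iter-suc parentOf j v))
        (subst (iter parentOf j (parentOf v) ∈_) (sym e)
          (∈-++⁺ˡ (go fuel' (parentOf v) (≤-pred (≤-trans (length-chain-parent v e) le)) j)))

  ∈-chain⇒ancestor : ∀ u v → u ∈ chain v → ∃ λ j → iter parentOf j v ≡ u
  ∈-chain⇒ancestor u v = go (length (chain v)) v ≤-refl
    where
    go : ∀ fuel v → length (chain v) ≤ fuel → u ∈ chain v → ∃ λ j → iter parentOf j v ≡ u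
    go fuel v le m with chain-parent v
    ... | inj₁ (e , _) with subst (u ∈_) e m
    ...   | here refl = 0 , refl
    go fuel v le m | inj₂ e with ∈-++⁻ (chain (parentOf v)) (subst (u ∈_) e m)
    ... | inj₂ (here refl) = 0 , refl
    ... | inj₁ m' with fuel
    ...   | zero = ⊥-elim (n≮0 (≤-trans (length-chain-parent v e) le))
    ...   | suc fuel' =
      let j , ej = go fuel' (parentOf v) (≤-pred (≤-trans (length-chain-parent v e) le)) m'
      in suc j , trans (iter-suc parentOf j v) ej

  ancestry : RootedTree n
  ancestry = record
    { root = root-vertex ; parent = parentOf ; parent-root = parentOf-root
    ; reaches = λ t →
        ∈-chain⇒ancestor root-vertex t (subst (root-vertex ∈_) (sym (proj₂ (chain-root t refl))) (here refl)) }

  -- Every bag is a single vertex: the tree nodes are the vertices themselves.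
  hierarchy : HierDecomp G
  hierarchy = record
    { m = n ; tree = ancestry ; bag = λ v → v ; bag-ne = λ t → t , refl
    ; edge-anc = λ u v uv → Sum.map (∈-chain⇒ancestor u v) (∈-chain⇒ancestor v u) (chain-edge u v refl refl uv) }

  order-length : length order ≤ n
  order-length = Unique-length order order-unique

  order-split : ∀ v → ∃₂ λ xs ys → order ≡ xs ++ v ∷ ys
  order-split v = ∈-∃++ (order-⊇ v refl)

  indexOf-order : ∀ xs v ys → order ≡ xs ++ v ∷ ys → indexOf v order ≡ length xs
  indexOf-order xs v ys e = trans (cong (indexOf v) e) (indexOf-++ xs v ys (subst Unique e order-unique))

  indexOf-order-< : ∀ v → indexOf v order < n
  indexOf-order-< v =
    let xs , ys , e = order-split v
    in ≤-trans (subst₂ _<_ (sym (indexOf-order xs v ys e)) (cong length (sym e)) (length-++-∷ xs v ys)) order-length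

  position : V → Fin n
  position v = fromℕ< (indexOf-order-< v)

  toℕ-position : ∀ v → toℕ (position v) ≡ indexOf v order
  toℕ-position v = toℕ-fromℕ< (indexOf-order-< v)

  position-injective : Injective _≡_ _≡_ position
  position-injective {x} {y} e =
    let xs , ys , ex = order-split x
        xs' , ys' , ey = order-split y
    in element-at-≡ xs xs' (trans (sym ex) ey)
         (trans (sym (indexOf-order xs x ys ex)) (trans (sym (toℕ-position x))
           (trans (cong toℕ e) (trans (toℕ-position y) (indexOf-order xs' y ys' ey)))))

  index-order : ∀ xs a ys → order ≡ xs ++ a ∷ ys → index position a ≡ suc (length xs)
  index-order xs a ys e = cong suc (trans (toℕ-position a) (indexOf-order xs a ys e))

  base : ℕ
  base = 2 + n

  open RunCode base

  module _ (v : V) where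

    point : V → Point
    point a = index position a , dist conn v a

    run-tail-valid : ∀ xs a as ys → order ≡ xs ++ (a ∷ as) ++ ys → Linked Adj (a ∷ as) →
                     ValidTail (index position a) (dist conn v a) (map point as)
    run-tail-valid xs a []       ys e _        = []
    run-tail-valid xs a (b ∷ bs) ys e (ab ∷ l) =
      subst (λ i → ValidTail (index position a) (dist conn v a) ((i , dist conn v b) ∷ map point bs)) (sym next)
        ((dist-adj conn v a b ab , dist-adj conn v b a (trans (adj-sym G b a) ab)) ∷
         subst (λ i → ValidTail i (dist conn v b) (map point bs)) next (run-tail-valid (xs ∷ʳ a) b bs ys e' l))
      where
      e' : order ≡ (xs ∷ʳ a) ++ b ∷ (bs ++ ys)
      e' = trans e (sym (∷ʳ-++ xs a (b ∷ bs ++ ys)))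
      next : index position b ≡ suc (index position a)
      next = trans (index-order (xs ∷ʳ a) b (bs ++ ys) e')
                   (cong suc (trans (length-++ xs {a ∷ []}) (trans (+-comm (length xs) 1)
                     (sym (index-order xs a (b ∷ bs ++ ys) e)))))

    runs-valid : ∀ rs → All (Run order) rs → ValidRuns (map (map point) rs)
    runs-valid []                 []                                      = []
    runs-valid (.(a ∷ as) ∷ rs) (((a , as , refl) , linked , xs , ys , e) ∷ g) =
      ((index< , s≤s (dist-≤ conn v a) , length<) , run-tail-valid xs a as ys e linked) ∷ runs-valid rs g
      where
      index< : index position a < base
      index< = s≤s (<-trans (toℕ<n (position a)) (n<1+n n))
      length< : length (map point as) < base
      length< = subst (_< base) (sym (length-map point as))
        (≤-trans (length-infix xs (a ∷ as) ys)
          (≤-trans (≤-reflexive (cong length (sym e))) (≤-trans order-length (≤-trans (n≤1+n n) (n≤1+n (suc n))))))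

    runs-≤-length : ∀ rs → All (Run order) rs → length rs ≤ length (concat rs)
    runs-≤-length []                 []                          = z≤n
    runs-≤-length (.(a ∷ as) ∷ rs) (((a , as , refl) , _) ∷ g) =
      s≤s (≤-trans (runs-≤-length rs g) (≤-trans (m≤n+m _ (length as)) (≤-reflexive (sym (length-++ as)))))

    private
      rs : List (List V)
      rs = proj₁ (runs v refl)
      concat-rs : concat rs ≡ chain v
      concat-rs = proj₁ (proj₂ (runs v refl))
      rs-runs : All (Run order) rs
      rs-runs = proj₁ (proj₂ (proj₂ (runs v refl)))
      few-runs : 2 ^ length rs ≤ 2 * count full
      few-runs = proj₂ (proj₂ (proj₂ (runs v refl)))

    points : List (List Point)
    points = map (map point) rs

    code : ℕ
    code = encode points

    concat-points : concat points ≡ map point (chain v)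
    concat-points = trans (concat-map rs) (cong (map point) concat-rs)

    length-chain : length (chain v) ≤ n
    length-chain = Unique-length (chain v) (chain-unique v refl)

    decode-code : decode n code ≡ map point (chain v)
    decode-code = trans (decode-encode n points (runs-valid rs rs-runs) fuel) concat-points
      where
      fuel : length points ≤ n
      fuel = ≤-trans (≤-reflexive (length-map (map point) rs))
               (≤-trans (runs-≤-length rs rs-runs) (≤-trans (≤-reflexive (cong length concat-rs)) length-chain))

    label : List Bool
    label = bits (ℕᵇ.fromℕ code)

    label-fits : 2 ≤ n → LabelFits 20 n label
    label-fits 2≤n =
      label-length n 2≤n (length label) code (length points) (length (concat points))
        (subst (λ m → 2 ^ length label ≤ suc m) (toℕ-fromℕ code) (2^length-bits (ℕᵇ.fromℕ code)))
        (encode-< points (runs-valid rs rs-runs))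
        (≤-trans (≤-reflexive (trans (cong length concat-points) (length-map point (chain v)))) length-chain)
        (≤-trans (≤-reflexive (cong (2 ^_) (length-map (map point) rs)))
          (≤-trans few-runs (*-monoʳ-≤ 2 (count-≤ full))))

    decoder-label : decoder n label ≡ (map (index position) (chain v) , map (dist conn v) (chain v))
    decoder-label = begin
      decoder n label
        ≡⟨ cong (λ x → decoder-on (decode n (ℕᵇ.toℕ x))) (unbits-bits (ℕᵇ.fromℕ code)) ⟩
      decoder-on (decode n (ℕᵇ.toℕ (ℕᵇ.fromℕ code)))
        ≡⟨ cong (decoder-on ∘ decode n) (toℕ-fromℕ code) ⟩
      decoder-on (decode n code)
        ≡⟨ cong decoder-on decode-code ⟩
      decoder-on (map point (chain v))
        ≡⟨ cong₂ _,_ (sym (map-∘ (chain v))) (sym (map-∘ (chain v))) ⟩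
      (map (index position) (chain v) , map (dist conn v) (chain v)) ∎
      where
      open ≡-Reasoning
      decoder-on : List Point → List ℕ × List ℕ
      decoder-on ps = map proj₁ ps , map proj₂ ps

    distances : Pointwise (λ a d → IsDist G v a d) (chain v) (map (dist conn v) (chain v))
    distances = Pointwise-map (dist-IsDist conn v) (chain v)

  ancestors-ordered : ∀ pre l → Unique (pre ++ l) →
                      (∀ ys a zs → l ≡ ys ++ a ∷ zs → chain a ≡ pre ++ ys ∷ʳ a) →
                      AllPairs (Before position hierarchy) l
  ancestors-ordered pre []      u h = []
  ancestors-ordered pre (a ∷ l) u h = earlier l (λ m → m) ∷ ancestors-ordered (pre ∷ʳ a) l u' h'
    where
    u' : Unique ((pre ∷ʳ a) ++ l)
    u' = subst Unique (sym (∷ʳ-++ pre a l)) u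
    a∉l : a ∉ l
    a∉l = Unique[x∷xs]⇒x∉xs (AllPairs-++⁻ʳ pre u)
    h' : ∀ ys b zs → l ≡ ys ++ b ∷ zs → chain b ≡ (pre ∷ʳ a) ++ ys ∷ʳ b
    h' ys b zs e = trans (h (a ∷ ys) b zs (cong (a ∷_) e)) (sym (++-assoc pre (a ∷ []) (ys ∷ʳ b)))
    earlier : ∀ l' → (∀ {b} → b ∈ l' → b ∈ l) → All (Before position hierarchy a) l'
    earlier []       _   = []
    earlier (b ∷ l') sub =
      inj₁ (∈-chain⇒ancestor a b a∈ , λ { refl → a∉l (sub (here refl)) }) ∷ earlier l' (sub ∘ there)
      where
      a∈ : a ∈ chain b
      a∈ = let ys , zs , e = ∈-∃++ (sub (here refl))
           in subst (a ∈_) (sym (h (a ∷ ys) b zs (cong (a ∷_) e))) (∈-++⁺ʳ pre (here refl))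

  natural-ancestors : ∀ v → NaturalAncestors position hierarchy v (chain v)
  natural-ancestors v =
    (λ u → to u , from u) ,
    ancestors-ordered [] (chain v) (chain-unique v refl) (λ ys a zs e → chain-prefix v ys a zs refl e)
    where
    to : ∀ u → u ∈ chain v → VAnc position hierarchy u v
    to u m with u ≟ v
    ... | yes refl = inj₂ (refl , ≤-refl)
    ... | no u≢v   = inj₁ (∈-chain⇒ancestor u v m , u≢v)
    from : ∀ u → VAnc position hierarchy u v → u ∈ chain v
    from u (inj₁ ((j , e) , _)) = subst (_∈ chain v) e (ancestor⇒∈-chain j v)
    from u (inj₂ (refl , _))    = ancestor⇒∈-chain 0 v

  labelling-correct : 2 ≤ n → ∀ v →
    LabelFits 20 n (label v) ×
    Σ (List V) λ as → NaturalAncestors position hierarchy v as ×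
    Σ (List ℕ) λ xs → Pointwise (λ a d → IsDist G v a d) as xs ×
    decoder n (label v) ≡ (map (index position) as , xs)
  labelling-correct 2≤n v =
    label-fits v 2≤n , chain v , natural-ancestors v , map (dist conn v) (chain v) , distances v , decoder-label v

theorem3p3 : Σ ℕ λ C → 0 < C × (∀ n → 2 ≤ n → HasHDVScheme n (LabelFits C n))
theorem3p3 = 20 , s≤s z≤n , λ n 2≤n → decoder n , λ G conn →
  let open Distances G
      vertex = fromℕ< (≤-trans (s≤s z≤n) 2≤n)
      RD = Decompositions.decompose-connected G n full vertex (full-connected conn) refl (count-≤ full)
      open Labelling G conn RD
  in position , position-injective , label , hierarchy , labelling-correct 2≤n
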